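{- Every quotient of an $\mathfrak{F}$-Cayley colour integral finite group is $\mathfrak{F}$-Cayley colour integral.
   Context: For a finite group $G$ and $f:G\to\mathbb{C}$ with $f(g)=f(g^{ -1})$, the Cayley colour graph $\operatorname{Cay}(G,f)$ has adjacency matrix $[f(gh^{ -1})]_{g,h\in G}$ and is integral if all its eigenvalues are integers. $G$ is $\mathfrak{F}$-Cayley colour integral if $\operatorname{Cay}(G,f)$ is integral for every class function $f:G\to\mathbb{Z}$ with $f(g)=f(g^{ -1})$ for all $g\in G$. -}

module Defs where

open import Data.Nat using (ℕ; zero; suc)
open import Data.Fin using (Fin; zero; suc; punchIn; _≟_; toℕ)
open import Data.Integer using (ℤ; +_; -_) renaming (_+_ to _+ℤ_; _*_ to _*ℤ_)
open import Data.List using (List; []; _∷_; map; foldr)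
open import Data.Bool using (if_then_else_)
open import Data.Product using (Σ; ∃; _,_; _×_)
open import Relation.Nullary using (does)
open import Relation.Binary.PropositionalEquality using (_≡_)

record FiniteGroup : Set where
  field
    order     : ℕ
    _∙_       : Fin order → Fin order → Fin order
    e         : Fin order
    _⁻¹       : Fin order → Fin order
    assoc     : ∀ x y z → (x ∙ y) ∙ z ≡ x ∙ (y ∙ z)
    identityˡ : ∀ x → e ∙ x ≡ x
    identityʳ : ∀ x → x ∙ e ≡ x
    inverseˡ  : ∀ x → (x ⁻¹) ∙ x ≡ e
    inverseʳ  : ∀ x → x ∙ (x ⁻¹) ≡ e

open FiniteGroup public

Elt : FiniteGroup → Set
Elt G = Fin (order G)

IsHomomorphism : (G H : FiniteGroup) → (Elt G → Elt H) → Set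
IsHomomorphism G H φ = ∀ x y → φ (_∙_ G x y) ≡ _∙_ H (φ x) (φ y)

IsSurjective : (G H : FiniteGroup) → (Elt G → Elt H) → Set
IsSurjective G H φ = ∀ y → ∃ λ x → φ x ≡ y

-- H is (isomorphic to) a quotient of G
IsQuotientOf : FiniteGroup → FiniteGroup → Set
IsQuotientOf H G = Σ (Elt G → Elt H) λ φ → IsHomomorphism G H φ × IsSurjective G H φ

-- Integer polynomials as coefficient lists (index i = coefficient of x^i)

Poly : Set
Poly = List ℤ

_+P_ : Poly → Poly → Poly
[] +P q = q
(a ∷ p) +P [] = a ∷ p
(a ∷ p) +P (b ∷ q) = (a +ℤ b) ∷ (p +P q)

_·P_ : ℤ → Poly → Poly
c ·P p = map (c *ℤ_) p

_*P_ : Poly → Poly → Poly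
[] *P q = []
(a ∷ p) *P q = (a ·P q) +P ((+ 0) ∷ (p *P q))

coeff : Poly → ℕ → ℤ
coeff [] k = + 0
coeff (a ∷ p) zero = a
coeff (a ∷ p) (suc k) = coeff p k

-- equality of polynomials (coefficientwise, ignoring trailing zeros)
_≈P_ : Poly → Poly → Set
p ≈P q = ∀ k → coeff p k ≡ coeff q k

sumFin : ∀ n → (Fin n → Poly) → Poly
sumFin zero f = []
sumFin (suc n) f = f zero +P sumFin n (λ i → f (suc i))

sign : ℕ → ℤ
sign zero = + 1
sign (suc k) = - sign k

det : ∀ n → (Fin n → Fin n → Poly) → Poly
det zero M = (+ 1) ∷ []
det (suc n) M =
  sumFin (suc n) λ j →
    sign (toℕ j) ·P (M zero j *P det n (λ i k → M (suc i) (punchIn j k)))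

charPoly : ∀ n → (Fin n → Fin n → ℤ) → Poly
charPoly n A = det n λ i j →
  if does (i ≟ j) then (- A i j) ∷ (+ 1) ∷ [] else (- A i j) ∷ []

linearFactors : List ℤ → Poly
linearFactors = foldr (λ l p → ((- l) ∷ (+ 1) ∷ []) *P p) ((+ 1) ∷ [])

IsIntegralMatrix : ∀ n → (Fin n → Fin n → ℤ) → Set
IsIntegralMatrix n A = ∃ λ (ls : List ℤ) → charPoly n A ≈P linearFactors ls

CayleyAdj : (G : FiniteGroup) → (Elt G → ℤ) → Elt G → Elt G → ℤ
CayleyAdj G f g h = f (_∙_ G g (_⁻¹ G h))

IsClassFunction : (G : FiniteGroup) → (Elt G → ℤ) → Set
IsClassFunction G f = ∀ x g → f (_∙_ G (_∙_ G x g) (_⁻¹ G x)) ≡ f g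

IsInverseSymmetric : (G : FiniteGroup) → (Elt G → ℤ) → Set
IsInverseSymmetric G f = ∀ g → f g ≡ f (_⁻¹ G g)

IsCayleyIntegral : (G : FiniteGroup) → (Elt G → ℤ) → Set
IsCayleyIntegral G f = IsIntegralMatrix (order G) (CayleyAdj G f)

FCayleyColourIntegral : FiniteGroup → Set
FCayleyColourIntegral G =
  (f : Elt G → ℤ) → IsClassFunction G f → IsInverseSymmetric G f → IsCayleyIntegral G f

{-# OPTIONS --safe #-}

-- Let φ : G → H be surjective with kernel of size k, f a class function on H and B its
-- Cayley matrix. Then f ∘ φ is a class function on G whose Cayley matrix is
-- A x y = B (φ x) (φ y). Elementary row and column operations collapse every fibre of φ
-- to a point and give det (t I - A) = tᵉ det (t I - k B), so k B has integer eigenvalues.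
-- Each of them is k times a rational root of the monic integer polynomial det (x I - B),
-- hence divisible by k, and the quotients are the eigenvalues of B.

module Submission where

open import Algebra.Bundles using (Group)
import Algebra.Properties.Group
open import Data.Bool using (Bool; true; false; if_then_else_)
open import Data.Empty using (⊥-elim)
open import Data.Fin using (Fin; zero; suc; punchIn; punchOut; toℕ; lift; _≟_)
import Data.Fin.Properties as FinP
open import Data.Fin.Permutation as Perm using (Permutation; Permutation′; _⟨$⟩ʳ_)
import Data.Integer as ℤ
open import Data.Integer using (ℤ; +_; -_; _+_; _*_; _-_; _^_; 0ℤ; 1ℤ; ∣_∣)
open import Data.Integer.Divisibility.Signed
  using (_∣_; divides; ∣-refl; ∣m∣n⇒∣m+n; ∣n⇒∣m*n; ∣m⇒∣m*n; ∣m⇒∣-m; ∣⇒∣ᵤ; ∣ᵤ⇒∣)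
import Data.Integer.Properties as ℤP
open import Data.Integer.Tactic.RingSolver using (solve-∀)
open import Data.List using (List; []; _∷_; length; map)
open import Data.List.Properties using (length-map)
open import Data.Nat as ℕ using (ℕ; zero; suc)
open import Data.Nat.Coprimality as Coprime using (Coprime; coprime-divisor; coprime-/gcd)
import Data.Nat.Divisibility as ℕDiv
open import Data.Nat.DivMod using (m/n*n≡m)
open import Data.Nat.GCD using (gcd; gcd[m,n]∣m; gcd[m,n]∣n; gcd[m,n]≢0)
import Data.Nat.Properties as ℕP
open import Data.Product using (∃-syntax; _,_; _×_; proj₁; proj₂)
open import Data.Sum using (inj₁; inj₂)
open import Function using (_∘_)
open import Level using (0ℓ)
open import Relation.Binary using (tri<; tri≈; tri>)
open import Relation.Binary.PropositionalEquality
open import Relation.Nullary using (does; yes; no; contradiction)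
open import Relation.Nullary.Decidable using (dec-true; dec-false)
open import Algebra.Properties.Semiring.Sum ℤP.+-*-semiring
  using (sum; sum-syntax; sum-cong-≗; sum-replicate-zero; sum-remove; sum-permute; ∑-distrib-+; ∑-comm; *-distribˡ-sum)

open import Defs

sum-zero : ∀ {n} {f : Fin n → ℤ} → (∀ i → f i ≡ 0ℤ) → sum f ≡ 0ℤ
sum-zero {n} f≡0 = trans (sum-cong-≗ f≡0) (sum-replicate-zero n)

sum-single : ∀ {n} (f : Fin n → ℤ) p → (∀ i → i ≢ p → f i ≡ 0ℤ) → sum f ≡ f p
sum-single {suc n} f p f≡0 = begin
  sum f                      ≡⟨ sum-remove f ⟩
  f p + sum (f ∘ punchIn p)  ≡⟨ cong (λ s → f p + s) (sum-zero λ k → f≡0 _ (FinP.punchInᵢ≢i p k)) ⟩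
  f p + 0ℤ                   ≡⟨ ℤP.+-identityʳ (f p) ⟩
  f p                        ∎
  where open ≡-Reasoning

∑-neg : ∀ {n} (f : Fin n → ℤ) → ∑[ i < n ] (- f i) ≡ - sum f
∑-neg {zero}  f = refl
∑-neg {suc n} f =
  trans (cong (λ s → - f zero + s) (∑-neg (f ∘ suc))) (sym (ℤP.neg-distrib-+ (f zero) (sum (f ∘ suc))))

*-distribˡ-sum₂ : ∀ {n} a b (f : Fin n → ℤ) → a * (b * sum f) ≡ ∑[ i < n ] (a * (b * f i))
*-distribˡ-sum₂ a b f = trans (cong (a *_) (*-distribˡ-sum b f)) (*-distribˡ-sum a (λ i → b * f i))

i≡-i⇒i≡0 : ∀ {i} → i ≡ - i → i ≡ 0ℤ
i≡-i⇒i≡0 {i} i≡-i with ℤP.i*j≡0⇒i≡0∨j≡0 (+ 2) 2i≡0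
  where
  double : ∀ i → + 2 * i ≡ i + i
  double = solve-∀
  2i≡0 : + 2 * i ≡ 0ℤ
  2i≡0 = trans (double i) (trans (cong (λ j → i + j) i≡-i) (ℤP.+-inverseʳ i))
... | inj₂ i≡0 = i≡0

IsUnit : ℤ → Set
IsUnit ε = ε * ε ≡ 1ℤ

sign-unit : ∀ k → IsUnit (sign k)
sign-unit zero    = refl
sign-unit (suc k) = trans (neg-square (sign k)) (sign-unit k)
  where neg-square : ∀ s → - s * - s ≡ s * s
        neg-square = solve-∀

unit-* : ∀ ε δ → IsUnit ε → IsUnit δ → IsUnit (ε * δ)
unit-* ε δ ε²≡1 δ²≡1 = trans (regroup ε δ) (cong₂ _*_ ε²≡1 δ²≡1)
  where regroup : ∀ a b → a * b * (a * b) ≡ a * a * (b * b)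
        regroup = solve-∀

unit-cancel : ∀ ε x → IsUnit ε → ε * x ≡ 0ℤ → x ≡ 0ℤ
unit-cancel ε x ε²≡1 εx≡0 = begin
  x            ≡⟨ ℤP.*-identityˡ x ⟨
  1ℤ * x       ≡⟨ cong (_* x) ε²≡1 ⟨
  ε * ε * x    ≡⟨ ℤP.*-assoc ε ε x ⟩
  ε * (ε * x)  ≡⟨ cong (ε *_) εx≡0 ⟩
  ε * 0ℤ       ≡⟨ ℤP.*-zeroʳ ε ⟩
  0ℤ           ∎
  where open ≡-Reasoning

-- Determinants of integer matrices

Mat : ℕ → Set
Mat n = Fin n → Fin n → ℤ

minor : ∀ {A : Set} {n} → (Fin (suc n) → Fin (suc n) → A) → Fin (suc n) → Fin n → Fin n → A
minor M j i k = M (suc i) (punchIn j k)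

_ᵀ : ∀ {n} → Mat n → Mat n
(M ᵀ) i j = M j i

detℤ : ∀ n → Mat n → ℤ
laplaceTerm : ∀ n → Mat (suc n) → Fin (suc n) → ℤ

detℤ zero    M = 1ℤ
detℤ (suc n) M = sum (laplaceTerm n M)

laplaceTerm n M j = sign (toℕ j) * (M zero j * detℤ n (minor M j))

detℤ-cong : ∀ n {M N : Mat n} → (∀ i j → M i j ≡ N i j) → detℤ n M ≡ detℤ n N
detℤ-cong zero    M≡N = refl
detℤ-cong (suc n) M≡N = sum-cong-≗ λ j →
  cong₂ (λ a d → sign (toℕ j) * (a * d)) (M≡N zero j) (detℤ-cong n λ i k → M≡N (suc i) (punchIn j k))

detℤ-linear-col : ∀ n (c : Fin n) (a : ℤ) (M N P : Mat n) →
  (∀ i j → j ≢ c → M i j ≡ P i j) → (∀ i j → j ≢ c → N i j ≡ P i j) →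
  (∀ i → P i c ≡ a * M i c + N i c) → detℤ n P ≡ a * detℤ n M + detℤ n N
detℤ-linear-col (suc n) c a M N P M≡P N≡P Pc = begin
    sum (laplaceTerm n P)
  ≡⟨ sum-cong-≗ term ⟩
    ∑[ j < suc n ] (a * laplaceTerm n M j + laplaceTerm n N j)
  ≡⟨ ∑-distrib-+ (λ j → a * laplaceTerm n M j) (laplaceTerm n N) ⟩
    ∑[ j < suc n ] (a * laplaceTerm n M j) + detℤ (suc n) N
  ≡⟨ cong (_+ detℤ (suc n) N) (*-distribˡ-sum a (laplaceTerm n M)) ⟨
    a * detℤ (suc n) M + detℤ (suc n) N
  ∎
  where
  open ≡-Reasoning
  term : ∀ j → laplaceTerm n P j ≡ a * laplaceTerm n M j + laplaceTerm n N j
  term j with j ≟ c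
  ... | yes refl = begin
      s * (P zero j * detℤ n (minor P j))
    ≡⟨ cong₂ (λ x d → s * (x * d)) (Pc zero) dP≡dM ⟩
      s * ((a * M zero j + N zero j) * detℤ n (minor M j))
    ≡⟨ distrib s a (M zero j) (N zero j) (detℤ n (minor M j)) ⟩
      a * laplaceTerm n M j + s * (N zero j * detℤ n (minor M j))
    ≡⟨ cong (λ d → a * laplaceTerm n M j + s * (N zero j * d)) dN≡dM ⟨
      a * laplaceTerm n M j + laplaceTerm n N j
    ∎
    where
    s = sign (toℕ j)
    minor-c : ∀ {X : Mat (suc n)} → (∀ i j → j ≢ c → X i j ≡ P i j) →
              detℤ n (minor X c) ≡ detℤ n (minor P c)
    minor-c X≡P = detℤ-cong n λ i k → X≡P (suc i) (punchIn c k) (FinP.punchInᵢ≢i c k)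
    dP≡dM : detℤ n (minor P c) ≡ detℤ n (minor M c)
    dP≡dM = sym (minor-c M≡P)
    dN≡dM : detℤ n (minor N c) ≡ detℤ n (minor M c)
    dN≡dM = trans (minor-c N≡P) dP≡dM
    distrib : ∀ s a m n d → s * ((a * m + n) * d) ≡ a * (s * (m * d)) + s * (n * d)
    distrib = solve-∀
  ... | no j≢c = begin
      s * (P zero j * detℤ n (minor P j))
    ≡⟨ cong (λ d → s * (P zero j * d)) minor-linear ⟩
      s * (P zero j * (a * detℤ n (minor M j) + detℤ n (minor N j)))
    ≡⟨ distrib s a (P zero j) (detℤ n (minor M j)) (detℤ n (minor N j)) ⟩
      a * (s * (P zero j * detℤ n (minor M j))) + s * (P zero j * detℤ n (minor N j))
    ≡⟨ cong₂ (λ x y → a * (s * (x * _)) + s * (y * _)) (M≡P zero j j≢c) (N≡P zero j j≢c) ⟨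
      a * laplaceTerm n M j + laplaceTerm n N j
    ∎
    where
    s = sign (toℕ j)
    c′ = punchOut j≢c
    avoids-c : ∀ k → k ≢ c′ → punchIn j k ≢ c
    avoids-c k k≢c′ refl = k≢c′ (sym (FinP.punchOut-punchIn j))
    minor-linear : detℤ n (minor P j) ≡ a * detℤ n (minor M j) + detℤ n (minor N j)
    minor-linear = detℤ-linear-col n c′ a (minor M j) (minor N j) (minor P j)
      (λ i k k≢c′ → M≡P (suc i) (punchIn j k) (avoids-c k k≢c′))
      (λ i k k≢c′ → N≡P (suc i) (punchIn j k) (avoids-c k k≢c′))
      (λ i → subst (λ z → P (suc i) z ≡ a * M (suc i) z + N (suc i) z)
                   (sym (FinP.punchIn-punchOut j≢c)) (Pc (suc i)))
    distrib : ∀ s a p x y → s * (p * (a * x + y)) ≡ a * (s * (p * x)) + s * (p * y)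
    distrib = solve-∀

detℤ-expand-col₀ : ∀ n (M : Mat (suc n)) →
  detℤ (suc n) M ≡ ∑[ j < suc n ] (sign (toℕ j) * (M j zero * detℤ n (minor (M ᵀ) j ᵀ)))
detℤ-expand-col₀ zero    M = refl
detℤ-expand-col₀ (suc n) M = cong (λ rest → laplaceTerm (suc n) M zero + rest) (begin
    ∑[ k < suc n ] (- s k * (M zero (suc k) * detℤ (suc n) (minor M (suc k))))
  ≡⟨ sum-cong-≗ (λ k → cong (λ d → - s k * (M zero (suc k) * d)) (detℤ-expand-col₀ n (minor M (suc k)))) ⟩
    ∑[ k < suc n ] (- s k * (M zero (suc k) * ∑[ j < suc n ] (s j * (M (suc j) zero * X j k))))
  ≡⟨ sum-cong-≗ (λ k → *-distribˡ-sum₂ (- s k) (M zero (suc k)) λ j → s j * (M (suc j) zero * X j k)) ⟩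
    ∑[ k < suc n ] ∑[ j < suc n ] (- s k * (M zero (suc k) * (s j * (M (suc j) zero * X j k))))
  ≡⟨ ∑-comm (λ k j → - s k * (M zero (suc k) * (s j * (M (suc j) zero * X j k)))) ⟩
    ∑[ j < suc n ] ∑[ k < suc n ] (- s k * (M zero (suc k) * (s j * (M (suc j) zero * X j k))))
  ≡⟨ sum-cong-≗ (λ j → sum-cong-≗ λ k → exchange (s k) (s j) (M zero (suc k)) (M (suc j) zero) (X j k)) ⟩
    ∑[ j < suc n ] ∑[ k < suc n ] (- s j * (M (suc j) zero * (s k * (M zero (suc k) * X j k))))
  ≡⟨ sum-cong-≗ (λ j → *-distribˡ-sum₂ (- s j) (M (suc j) zero) λ k → s k * (M zero (suc k) * X j k)) ⟨
    ∑[ j < suc n ] (- s j * (M (suc j) zero * detℤ (suc n) (minor (M ᵀ) (suc j) ᵀ)))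
  ∎)
  where
  open ≡-Reasoning
  s : Fin (suc n) → ℤ
  s j = sign (toℕ j)
  X : Fin (suc n) → Fin (suc n) → ℤ
  X j k = detℤ n λ i l → M (suc (punchIn j i)) (suc (punchIn k l))
  exchange : ∀ sk sj a b x → (- sk) * (a * (sj * (b * x))) ≡ (- sj) * (b * (sk * (a * x)))
  exchange = solve-∀

detℤ-transpose : ∀ n (M : Mat n) → detℤ n (M ᵀ) ≡ detℤ n M
detℤ-transpose zero    M = refl
detℤ-transpose (suc n) M = trans
  (sum-cong-≗ λ j → cong (λ d → sign (toℕ j) * (M j zero * d)) (detℤ-transpose n (minor (M ᵀ) j ᵀ)))
  (sym (detℤ-expand-col₀ n M))

record HasColumnSign n (τ : Fin n → Fin n) (ε : ℤ) : Set where
  constructor columnSign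
  field scales : ∀ M → detℤ n (λ i j → M i (τ j)) ≡ ε * detℤ n M

open HasColumnSign

columnSign-cong : ∀ {n τ σ ε} → (∀ x → τ x ≡ σ x) → HasColumnSign n τ ε → HasColumnSign n σ ε
columnSign-cong {n} τ≗σ τε = columnSign λ M →
  trans (detℤ-cong n λ i j → cong (M i) (sym (τ≗σ j))) (scales τε M)

columnSign-∘ : ∀ {n τ σ ε δ} → HasColumnSign n τ ε → HasColumnSign n σ δ →
               HasColumnSign n (τ ∘ σ) (δ * ε)
columnSign-∘ {n} {τ} {ε = ε} {δ} τε σδ = columnSign λ M →
  trans (scales σδ (λ i j → M i (τ j))) (trans (cong (δ *_) (scales τε M)) (sym (ℤP.*-assoc δ ε (detℤ n M))))

columnSign-lift : ∀ {n τ ε} → HasColumnSign n τ ε → HasColumnSign (suc n) (lift 1 τ) ε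
columnSign-lift {n} {τ} {ε} τε = columnSign λ M → begin
    detℤ (suc n) (λ i j → M i (lift 1 τ j))
  ≡⟨ detℤ-expand-col₀ n (λ i j → M i (lift 1 τ j)) ⟩
    ∑[ j < suc n ] (sign (toℕ j) * (M j zero * detℤ n (λ i k → (minor (M ᵀ) j ᵀ) i (τ k))))
  ≡⟨ sum-cong-≗ (λ j → cong (λ d → sign (toℕ j) * (M j zero * d)) (scales τε (minor (M ᵀ) j ᵀ))) ⟩
    ∑[ j < suc n ] (sign (toℕ j) * (M j zero * (ε * detℤ n (minor (M ᵀ) j ᵀ))))
  ≡⟨ sum-cong-≗ (λ j → commute (sign (toℕ j)) (M j zero) ε (detℤ n (minor (M ᵀ) j ᵀ))) ⟩
    ∑[ j < suc n ] (ε * (sign (toℕ j) * (M j zero * detℤ n (minor (M ᵀ) j ᵀ))))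
  ≡⟨ *-distribˡ-sum ε (λ j → sign (toℕ j) * (M j zero * detℤ n (minor (M ᵀ) j ᵀ))) ⟨
    ε * ∑[ j < suc n ] (sign (toℕ j) * (M j zero * detℤ n (minor (M ᵀ) j ᵀ)))
  ≡⟨ cong (ε *_) (detℤ-expand-col₀ n M) ⟨
    ε * detℤ (suc n) M
  ∎
  where
  open ≡-Reasoning
  commute : ∀ s a e d → s * (a * (e * d)) ≡ e * (s * (a * d))
  commute = solve-∀

swap₀ : ∀ {n} → Fin (suc (suc n)) → Fin (suc (suc n))
swap₀ zero          = suc zero
swap₀ (suc zero)    = zero
swap₀ (suc (suc k)) = suc (suc k)

swap₀-punchIn : ∀ {n} (j : Fin (suc n)) k → swap₀ (punchIn (suc (suc j)) k) ≡ punchIn (suc (suc j)) (swap₀ k)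
swap₀-punchIn j zero          = refl
swap₀-punchIn j (suc zero)    = refl
swap₀-punchIn j (suc (suc k)) = refl

detℤ-swap₀ : ∀ n (M : Mat (suc (suc n))) →
  detℤ (suc (suc n)) (λ i j → M i (swap₀ j)) ≡ - 1ℤ * detℤ (suc (suc n)) M
laplaceTerm-swap₀ : ∀ n (M : Mat (suc (suc n))) (j : Fin n) →
  laplaceTerm (suc n) (λ i k → M i (swap₀ k)) (suc (suc j)) ≡ - laplaceTerm (suc n) M (suc (suc j))

detℤ-swap₀ n M = begin
    laplaceTerm (suc n) S zero + (laplaceTerm (suc n) S (suc zero) + r′)
  ≡⟨ cong₂ (λ x y → x + (y + r′)) (cong (λ d → 1ℤ * (a * d)) (detℤ-cong (suc n) minor₀))
                                  (cong (λ d → - 1ℤ * (b * d)) (detℤ-cong (suc n) minor₁)) ⟩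
    1ℤ * (a * d₁) + (- 1ℤ * (b * d₀) + r′)
  ≡⟨ cong (λ z → 1ℤ * (a * d₁) + (- 1ℤ * (b * d₀) + z)) r′≡-r ⟩
    1ℤ * (a * d₁) + (- 1ℤ * (b * d₀) + - r)
  ≡⟨ exchange a d₁ b d₀ r ⟩
    - 1ℤ * detℤ (suc (suc n)) M
  ∎
  where
  open ≡-Reasoning
  S : Mat (suc (suc n))
  S i k = M i (swap₀ k)
  a = M zero (suc zero)
  b = M zero zero
  d₀ = detℤ (suc n) (minor M zero)
  d₁ = detℤ (suc n) (minor M (suc zero))
  r = ∑[ j < n ] laplaceTerm (suc n) M (suc (suc j))
  r′ = ∑[ j < n ] laplaceTerm (suc n) S (suc (suc j))
  r′≡-r : r′ ≡ - r
  r′≡-r = trans (sum-cong-≗ (laplaceTerm-swap₀ n M)) (∑-neg (λ j → laplaceTerm (suc n) M (suc (suc j))))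
  minor₀ : ∀ i k → minor S zero i k ≡ minor M (suc zero) i k
  minor₀ i zero    = refl
  minor₀ i (suc k) = refl
  minor₁ : ∀ i k → minor S (suc zero) i k ≡ minor M zero i k
  minor₁ i zero    = refl
  minor₁ i (suc k) = refl
  exchange : ∀ a d₁ b d₀ r →
             1ℤ * (a * d₁) + (- 1ℤ * (b * d₀) + - r) ≡ - 1ℤ * (1ℤ * (b * d₀) + (- 1ℤ * (a * d₁) + r))
  exchange = solve-∀

laplaceTerm-swap₀ (suc n) M j = trans
  (cong (λ d → s * (M zero (suc (suc j)) * d))
        (trans (detℤ-cong (suc (suc n)) λ i k → cong (M (suc i)) (swap₀-punchIn j k))
               (detℤ-swap₀ n (minor M (suc (suc j))))))
  (negate-inner s (M zero (suc (suc j))) (detℤ (suc (suc n)) (minor M (suc (suc j)))))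
  where
  s = sign (toℕ (suc (suc j)))
  negate-inner : ∀ s a d → s * (a * (- 1ℤ * d)) ≡ - (s * (a * d))
  negate-inner = solve-∀

columnSign-swap₀ : ∀ n → HasColumnSign (suc (suc n)) swap₀ (- 1ℤ)
columnSign-swap₀ n = columnSign (detℤ-swap₀ n)

rotate : ∀ {n} → Fin (suc n) → Fin (suc n) → Fin (suc n)
rotate j zero    = j
rotate j (suc k) = punchIn j k

rotate-zero : ∀ {n} (x : Fin (suc n)) → rotate zero x ≡ x
rotate-zero zero    = refl
rotate-zero (suc x) = refl

rotate-suc : ∀ {n} (c : Fin (suc n)) x → rotate (suc c) x ≡ lift 1 (rotate c) (swap₀ x)
rotate-suc c zero          = refl
rotate-suc c (suc zero)    = refl
rotate-suc c (suc (suc x)) = refl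

columnSign-rotate : ∀ n (j : Fin (suc n)) → HasColumnSign (suc n) (rotate j) (sign (toℕ j))
columnSign-rotate n zero = columnSign λ M →
  trans (detℤ-cong (suc n) λ i x → cong (M i) (rotate-zero x)) (sym (ℤP.*-identityˡ (detℤ (suc n) M)))
columnSign-rotate (suc n) (suc c) = subst (HasColumnSign _ (rotate (suc c))) (ℤP.-1*i≡-i (sign (toℕ c)))
  (columnSign-cong (sym ∘ rotate-suc c)
    (columnSign-∘ (columnSign-lift (columnSign-rotate n c)) (columnSign-swap₀ n)))

columnSign-permutation : ∀ n (π : Permutation′ n) → ∃[ ε ] IsUnit ε × HasColumnSign n (π ⟨$⟩ʳ_) ε
columnSign-permutation zero    π = 1ℤ , refl , columnSign λ M → refl
columnSign-permutation (suc n) π with columnSign-permutation n (Perm.remove zero π)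
... | ε , ε-unit , τε = ε * sign (toℕ j) , unit-* ε (sign (toℕ j)) ε-unit (sign-unit (toℕ j)) ,
  columnSign-cong (sym ∘ decompose) (columnSign-∘ (columnSign-rotate n j) (columnSign-lift τε))
  where
  j = π ⟨$⟩ʳ zero
  decompose : ∀ x → π ⟨$⟩ʳ x ≡ rotate j (lift 1 (Perm.remove zero π ⟨$⟩ʳ_) x)
  decompose zero    = refl
  decompose (suc k) = Perm.punchIn-permute π zero k

detℤ-relabel : ∀ {n τ ε} → IsUnit ε → HasColumnSign n τ ε →
               ∀ M → detℤ n (λ i j → M (τ i) (τ j)) ≡ detℤ n M
detℤ-relabel {n} {τ} {ε} ε-unit τε M = begin
  detℤ n (λ i j → M (τ i) (τ j))  ≡⟨ scales τε (λ i j → M (τ i) j) ⟩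
  ε * detℤ n (λ i j → M (τ i) j)  ≡⟨ cong (ε *_) rows ⟩
  ε * (ε * detℤ n M)              ≡⟨ ℤP.*-assoc ε ε (detℤ n M) ⟨
  ε * ε * detℤ n M                ≡⟨ cong (_* detℤ n M) ε-unit ⟩
  1ℤ * detℤ n M                   ≡⟨ ℤP.*-identityˡ (detℤ n M) ⟩
  detℤ n M                        ∎
  where
  open ≡-Reasoning
  rows : detℤ n (λ i j → M (τ i) j) ≡ ε * detℤ n M
  rows = trans (detℤ-transpose n (λ i j → M (τ j) i))
               (trans (scales τε (M ᵀ)) (cong (ε *_) (detℤ-transpose n M)))

detℤ-permute : ∀ {m n} (π : Permutation m n) (M : Mat n) →
               detℤ m (λ i j → M (π ⟨$⟩ʳ i) (π ⟨$⟩ʳ j)) ≡ detℤ n M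
detℤ-permute π M with Perm.↔⇒≡ π
... | refl with columnSign-permutation _ π
...   | ε , ε-unit , πε = detℤ-relabel ε-unit πε M

detℤ-equal-cols₀₁ : ∀ n (M : Mat (suc (suc n))) → (∀ i → M i zero ≡ M i (suc zero)) →
                    detℤ (suc (suc n)) M ≡ 0ℤ
detℤ-equal-cols₀₁ n M M₀≡M₁ = i≡-i⇒i≡0 (begin
  detℤ _ M                        ≡⟨ detℤ-cong _ swapped ⟩
  detℤ _ (λ i j → M i (swap₀ j))  ≡⟨ detℤ-swap₀ n M ⟩
  - 1ℤ * detℤ _ M                 ≡⟨ ℤP.-1*i≡-i _ ⟩
  - detℤ _ M                      ∎)
  where
  open ≡-Reasoning
  swapped : ∀ i j → M i j ≡ M i (swap₀ j)
  swapped i zero          = M₀≡M₁ i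
  swapped i (suc zero)    = sym (M₀≡M₁ i)
  swapped i (suc (suc j)) = refl

detℤ-equal-cols : ∀ n (M : Mat n) a b → a ≢ b → (∀ i → M i a ≡ M i b) → detℤ n M ≡ 0ℤ
detℤ-equal-cols (suc zero)    M zero zero a≢b _     = ⊥-elim (a≢b refl)
detℤ-equal-cols (suc (suc n)) M a    b    a≢b Ma≡Mb =
  unit-cancel (sign (toℕ (suc b′)) * sign (toℕ a)) (detℤ _ M)
    (unit-* (sign (toℕ (suc b′))) (sign (toℕ a)) (sign-unit (toℕ (suc b′))) (sign-unit (toℕ a)))
    (trans (sym (scales ρε M)) (detℤ-equal-cols₀₁ n (λ i j → M i (ρ j)) b≡a))
  where
  b′ = punchOut a≢b
  ρ = rotate a ∘ rotate (suc b′)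
  ρε = columnSign-∘ (columnSign-rotate (suc n) a) (columnSign-rotate (suc n) (suc b′))
  b≡a : ∀ i → M i (punchIn a b′) ≡ M i a
  b≡a i = trans (cong (M i) (FinP.punchIn-punchOut a≢b)) (sym (Ma≡Mb i))

if-≟-yes : ∀ {n} {A : Set} {x y : Fin n} {a b : A} → x ≡ y → (if does (x ≟ y) then a else b) ≡ a
if-≟-yes {x = x} {y} {a} {b} x≡y = cong (if_then a else b) (dec-true (x ≟ y) x≡y)

if-≟-no : ∀ {n} {A : Set} {x y : Fin n} {a b : A} → x ≢ y → (if does (x ≟ y) then a else b) ≡ b
if-≟-no {x = x} {y} {a} {b} x≢y = cong (if_then a else b) (dec-false (x ≟ y) x≢y)

detℤ-add-col-multiple : ∀ n (M N : Mat n) a b x → a ≢ b → (∀ i j → j ≢ a → N i j ≡ M i j) →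
                        (∀ i → N i a ≡ M i a + x * M i b) → detℤ n N ≡ detℤ n M
detℤ-add-col-multiple n M N a b x a≢b N≡M Na = begin
  detℤ n N                  ≡⟨ detℤ-linear-col n a x M′ M N M′≡N (λ i j j≢a → sym (N≡M i j j≢a)) Na′ ⟩
  x * detℤ n M′ + detℤ n M  ≡⟨ cong (λ d → x * d + detℤ n M) M′-singular ⟩
  x * 0ℤ + detℤ n M         ≡⟨ cong (_+ detℤ n M) (ℤP.*-zeroʳ x) ⟩
  0ℤ + detℤ n M             ≡⟨ ℤP.+-identityˡ (detℤ n M) ⟩
  detℤ n M                  ∎
  where
  open ≡-Reasoning
  M′ : Mat n
  M′ i j = if does (j ≟ a) then M i b else M i j
  M′-singular : detℤ n M′ ≡ 0ℤ
  M′-singular = detℤ-equal-cols n M′ a b a≢b λ i → trans (if-≟-yes {x = a} refl) (sym (if-≟-no (a≢b ∘ sym)))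
  M′≡N : ∀ i j → j ≢ a → M′ i j ≡ N i j
  M′≡N i j j≢a = trans (if-≟-no j≢a) (sym (N≡M i j j≢a))
  Na′ : ∀ i → N i a ≡ x * M′ i a + M i a
  Na′ i = trans (Na i)
    (trans (ℤP.+-comm (M i a) (x * M i b)) (cong (λ y → x * y + M i a) (sym (if-≟-yes {x = a} refl))))

detℤ-add-row-multiple : ∀ n (M N : Mat n) a b x → a ≢ b → (∀ i j → i ≢ a → N i j ≡ M i j) →
                        (∀ j → N a j ≡ M a j + x * M b j) → detℤ n N ≡ detℤ n M
detℤ-add-row-multiple n M N a b x a≢b N≡M Na = begin
  detℤ n N      ≡⟨ detℤ-transpose n N ⟨
  detℤ n (N ᵀ)  ≡⟨ detℤ-add-col-multiple n (M ᵀ) (N ᵀ) a b x a≢b (λ i j → N≡M j i) Na ⟩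
  detℤ n (M ᵀ)  ≡⟨ detℤ-transpose n M ⟩
  detℤ n M      ∎
  where open ≡-Reasoning

detℤ-expand-sparse-row : ∀ n (M : Mat (suc n)) p → (∀ j → j ≢ p → M p j ≡ 0ℤ) →
                         detℤ (suc n) M ≡ M p p * detℤ n (λ i k → M (punchIn p i) (punchIn p k))
detℤ-expand-sparse-row n M p row-p = begin
  detℤ (suc n) M                        ≡⟨ detℤ-relabel (sign-unit (toℕ p)) (columnSign-rotate n p) M ⟨
  detℤ (suc n) R                        ≡⟨ sum-single (laplaceTerm n R) zero off-diagonal ⟩
  1ℤ * (M p p * detℤ n (minor R zero))  ≡⟨ ℤP.*-identityˡ _ ⟩
  M p p * detℤ n (minor R zero)         ∎
  where
  open ≡-Reasoning
  R : Mat (suc n)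
  R i j = M (rotate p i) (rotate p j)
  off-diagonal : ∀ j → j ≢ zero → laplaceTerm n R j ≡ 0ℤ
  off-diagonal zero    0≢0 = ⊥-elim (0≢0 refl)
  off-diagonal (suc k) _   = begin
    s * (M p (punchIn p k) * d)  ≡⟨ cong (λ a → s * (a * d)) (row-p _ (FinP.punchInᵢ≢i p k)) ⟩
    s * (0ℤ * d)                 ≡⟨ cong (s *_) (ℤP.*-zeroˡ d) ⟩
    s * 0ℤ                       ≡⟨ ℤP.*-zeroʳ s ⟩
    0ℤ                           ∎
    where
    s = sign (toℕ (suc k))
    d = detℤ n (minor R (suc k))

scalar : ∀ {n} → ℤ → Mat n
scalar t i j = if does (i ≟ j) then t else 0ℤ

scalar-* : ∀ {n} g a (i j : Fin n) → scalar (a * g) i j ≡ g * scalar a i j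
scalar-* g a i j with i ≟ j
... | yes _ = ℤP.*-comm a g
... | no _  = sym (ℤP.*-zeroʳ g)

infixr 7 _·ᴹ_
_·ᴹ_ : ∀ {n} → ℤ → Mat n → Mat n
(a ·ᴹ M) i j = a * M i j

detℤ-scale : ∀ n a (M : Mat n) → detℤ n (a ·ᴹ M) ≡ a ^ n * detℤ n M
detℤ-scale zero    a M = refl
detℤ-scale (suc n) a M = trans (sum-cong-≗ term) (sym (*-distribˡ-sum (a ^ suc n) (laplaceTerm n M)))
  where
  term : ∀ j → laplaceTerm n (a ·ᴹ M) j ≡ a ^ suc n * laplaceTerm n M j
  term j = trans (cong (λ d → sign (toℕ j) * (a * M zero j * d)) (detℤ-scale n a (minor M j)))
                 (regroup (sign (toℕ j)) a (M zero j) (a ^ n) (detℤ n (minor M j)))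
    where regroup : ∀ s a x p d → s * (a * x * (p * d)) ≡ a * p * (s * (x * d))
          regroup = solve-∀

detℤ-scalar : ∀ n a → detℤ n (scalar a) ≡ a ^ n
detℤ-scalar zero    a = refl
detℤ-scalar (suc n) a = trans (detℤ-expand-sparse-row n (scalar a) zero λ j j≢0 → if-≟-no (j≢0 ∘ sym))
                              (cong (a *_) (detℤ-scalar n a))

detℤ-congruent : ∀ n b (M N : Mat n) → (∀ i j → b ∣ (M i j - N i j)) → b ∣ (detℤ n M - detℤ n N)
detℤ-congruent zero    b M N _   = divides 0ℤ (sym (ℤP.*-zeroˡ b))
detℤ-congruent (suc n) b M N M≡N = subst (b ∣_) difference (sum-divisible term)
  where
  difference : ∑[ j < suc n ] (laplaceTerm n M j - laplaceTerm n N j) ≡ detℤ (suc n) M - detℤ (suc n) N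
  difference = trans (∑-distrib-+ (laplaceTerm n M) (λ j → - laplaceTerm n N j))
                     (cong (λ s → detℤ (suc n) M + s) (∑-neg (laplaceTerm n N)))
  sum-divisible : ∀ {n} {f : Fin n → ℤ} → (∀ i → b ∣ f i) → b ∣ sum f
  sum-divisible {zero}  _   = divides 0ℤ (sym (ℤP.*-zeroˡ b))
  sum-divisible {suc n} b∣f = ∣m∣n⇒∣m+n (b∣f zero) (sum-divisible (b∣f ∘ suc))
  term : ∀ j → b ∣ (laplaceTerm n M j - laplaceTerm n N j)
  term j = subst (b ∣_) (sym (split (sign (toℕ j)) (M zero j) (N zero j) dM dN))
    (∣n⇒∣m*n (sign (toℕ j)) (∣m∣n⇒∣m+n (∣n⇒∣m*n (M zero j) minors) (∣m⇒∣m*n dN (M≡N zero j))))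
    where
    dM = detℤ n (minor M j)
    dN = detℤ n (minor N j)
    minors : b ∣ (dM - dN)
    minors = detℤ-congruent n b (minor M j) (minor N j) λ i k → M≡N (suc i) (punchIn j k)
    split : ∀ s a c x y → s * (a * x) - s * (c * y) ≡ s * (a * (x - y) + (a - c) * y)
    split = solve-∀

-- Collapsing the fibres of a map

scalar-reindex : ∀ {m n} (f : Fin m → Fin n) → (∀ {i j} → f i ≡ f j → i ≡ j) →
                 ∀ t i j → scalar t (f i) (f j) ≡ scalar t i j
scalar-reindex f f-injective t i j with i ≟ j
... | yes refl = if-≟-yes {x = f i} refl
... | no i≢j   = if-≟-no (i≢j ∘ f-injective)

charMat : ∀ {n} → ℤ → Mat n → Mat n
charMat t A i j = scalar t i j - A i j

blowUp : ∀ {N m} → (Fin N → Fin m) → (Fin N → ℤ) → Mat m → Mat N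
blowUp ψ c B x y = c y * B (ψ x) (ψ y)

fibreWeight : ∀ {N m} → (Fin N → Fin m) → (Fin N → ℤ) → Fin m → ℤ
fibreWeight {N} ψ c j = ∑[ x < N ] (if does (ψ x ≟ j) then c x else 0ℤ)

scaleCols : ∀ {m} → (Fin m → ℤ) → Mat m → Mat m
scaleCols w B i j = w j * B i j

-- Subtracting row p from row x₀ and then adding column x₀ to column p turns row x₀ into
-- t times a unit vector; expanding along it leaves the same kind of matrix on the other
-- points, with the weight of x₀ moved onto its twin p.
module CollapseStep {N m} (ψ : Fin (suc N) → Fin m) (c : Fin (suc N) → ℤ) (B : Mat m)
                    {x₀ p : Fin (suc N)} (x₀≢p : x₀ ≢ p) (ψp≡ψx₀ : ψ p ≡ ψ x₀) where

  ψ′ : Fin N → Fin m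
  ψ′ = ψ ∘ punchIn x₀

  c′ : Fin N → ℤ
  c′ k = c (punchIn x₀ k) + (if does (punchIn x₀ k ≟ p) then c x₀ else 0ℤ)

  fibreWeight-c′ : ∀ j → fibreWeight ψ′ c′ j ≡ fibreWeight ψ c j
  fibreWeight-c′ j = begin
    fibreWeight ψ′ c′ j                  ≡⟨ sum-cong-≗ split ⟩
    ∑[ k < N ] (f (punchIn x₀ k) + g k)  ≡⟨ ∑-distrib-+ (f ∘ punchIn x₀) g ⟩
    sum (f ∘ punchIn x₀) + sum g         ≡⟨ cong (λ r → sum (f ∘ punchIn x₀) + r) (sum-single g k₀ g-off-k₀) ⟩
    sum (f ∘ punchIn x₀) + g k₀          ≡⟨ cong (λ r → sum (f ∘ punchIn x₀) + r) g-k₀ ⟩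
    sum (f ∘ punchIn x₀) + f x₀          ≡⟨ ℤP.+-comm (sum (f ∘ punchIn x₀)) (f x₀) ⟩
    f x₀ + sum (f ∘ punchIn x₀)          ≡⟨ sum-remove f ⟨
    fibreWeight ψ c j                    ∎
    where
    open ≡-Reasoning
    f : Fin (suc N) → ℤ
    f x = if does (ψ x ≟ j) then c x else 0ℤ
    g : Fin N → ℤ
    g k = if does (punchIn x₀ k ≟ p) then f x₀ else 0ℤ
    k₀ : Fin N
    k₀ = punchOut x₀≢p
    g-off-k₀ : ∀ k → k ≢ k₀ → g k ≡ 0ℤ
    g-off-k₀ k k≢k₀ = if-≟-no {x = punchIn x₀ k} λ { refl → k≢k₀ (sym (FinP.punchOut-punchIn x₀)) }
    g-k₀ : g k₀ ≡ f x₀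
    g-k₀ = if-≟-yes (FinP.punchIn-punchOut x₀≢p)
    split : ∀ k → (if does (ψ′ k ≟ j) then c′ k else 0ℤ) ≡ f (punchIn x₀ k) + g k
    split k with ψ (punchIn x₀ k) ≟ j | punchIn x₀ k ≟ p
    ... | yes _    | no _  = refl
    ... | no _     | no _  = refl
    ... | yes ψk≡j | yes refl = cong (λ w → c p + w) (sym (if-≟-yes (trans (sym ψp≡ψx₀) ψk≡j)))
    ... | no ψk≢j  | yes refl =
      sym (trans (ℤP.+-identityˡ (f x₀)) (if-≟-no (λ ψx₀≡j → ψk≢j (trans ψp≡ψx₀ ψx₀≡j))))

  detℤ-step : ∀ t → detℤ (suc N) (charMat t (blowUp ψ c B)) ≡ t * detℤ N (charMat t (blowUp ψ′ c′ B))
  detℤ-step t = begin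
      detℤ (suc N) K₀
    ≡⟨ detℤ-add-row-multiple (suc N) K₀ K₁ x₀ p (- 1ℤ) x₀≢p (λ i j → if-≟-no)
                             (λ j → if-≟-yes {x = x₀} refl) ⟨
      detℤ (suc N) K₁
    ≡⟨ detℤ-add-col-multiple (suc N) K₁ K₂ p x₀ 1ℤ (x₀≢p ∘ sym) (λ i j → if-≟-no)
                             (λ i → if-≟-yes {x = p} refl) ⟨
      detℤ (suc N) K₂
    ≡⟨ detℤ-expand-sparse-row N K₂ x₀ K₂-row-x₀ ⟩
      K₂ x₀ x₀ * detℤ N (λ i k → K₂ (punchIn x₀ i) (punchIn x₀ k))
    ≡⟨ cong₂ _*_ K₂-x₀x₀ (detℤ-cong N K₂-minor) ⟩
      t * detℤ N (charMat t (blowUp ψ′ c′ B))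
    ∎
    where
    open ≡-Reasoning
    s : ∀ {n} → Mat n
    s = scalar t
    K₀ K₁ K₂ : Mat (suc N)
    K₀ = charMat t (blowUp ψ c B)
    K₁ x y = if does (x ≟ x₀) then K₀ x₀ y + - 1ℤ * K₀ p y else K₀ x y
    K₂ x y = if does (y ≟ p) then K₁ x p + 1ℤ * K₁ x x₀ else K₁ x y

    K₁-row-x₀ : ∀ y → K₁ x₀ y ≡ s x₀ y - s p y
    K₁-row-x₀ y = begin
      K₁ x₀ y                                         ≡⟨ if-≟-yes {x = x₀} refl ⟩
      K₀ x₀ y + - 1ℤ * (s p y - c y * B (ψ p) (ψ y))  ≡⟨ cong (λ h → K₀ x₀ y + - 1ℤ * (s p y - c y * B h (ψ y)))
                                                              ψp≡ψx₀ ⟩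
      (s x₀ y - w) + - 1ℤ * (s p y - w)               ≡⟨ cancel (s x₀ y) (s p y) w ⟩
      s x₀ y - s p y                                  ∎
      where
      w = c y * B (ψ x₀) (ψ y)
      cancel : ∀ a d w → (a - w) + - 1ℤ * (d - w) ≡ a - d
      cancel = solve-∀

    K₂-row-x₀ : ∀ y → y ≢ x₀ → K₂ x₀ y ≡ 0ℤ
    K₂-row-x₀ y y≢x₀ with y ≟ p
    ... | yes refl = begin
      K₁ x₀ y + 1ℤ * K₁ x₀ x₀                    ≡⟨ cong₂ (λ a b → a + 1ℤ * b) (K₁-row-x₀ y) (K₁-row-x₀ x₀) ⟩
      (s x₀ y - s y y) + 1ℤ * (s x₀ x₀ - s y x₀) ≡⟨ cong₂ (λ a b → (a - s y y) + 1ℤ * (s x₀ x₀ - b))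
                                                          (if-≟-no (y≢x₀ ∘ sym)) (if-≟-no y≢x₀) ⟩
      (0ℤ - s y y) + 1ℤ * (s x₀ x₀ - 0ℤ)         ≡⟨ cong₂ (λ a b → (0ℤ - a) + 1ℤ * (b - 0ℤ))
                                                          (if-≟-yes {x = y} refl) (if-≟-yes {x = x₀} refl) ⟩
      (0ℤ - t) + 1ℤ * (t - 0ℤ)                   ≡⟨ cancel t ⟩
      0ℤ                                         ∎
      where cancel : ∀ t → (0ℤ - t) + 1ℤ * (t - 0ℤ) ≡ 0ℤ
            cancel = solve-∀
    ... | no y≢p = begin
      K₁ x₀ y         ≡⟨ K₁-row-x₀ y ⟩
      s x₀ y - s p y  ≡⟨ cong₂ _-_ (if-≟-no (y≢x₀ ∘ sym)) (if-≟-no (y≢p ∘ sym)) ⟩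
      0ℤ              ∎

    K₂-x₀x₀ : K₂ x₀ x₀ ≡ t
    K₂-x₀x₀ = begin
      K₂ x₀ x₀          ≡⟨ if-≟-no x₀≢p ⟩
      K₁ x₀ x₀          ≡⟨ K₁-row-x₀ x₀ ⟩
      s x₀ x₀ - s p x₀  ≡⟨ cong₂ _-_ (if-≟-yes {x = x₀} refl) (if-≟-no (x₀≢p ∘ sym)) ⟩
      t - 0ℤ            ≡⟨ ℤP.+-identityʳ t ⟩
      t                 ∎

    K₁-off-x₀ : ∀ i y → K₁ (punchIn x₀ i) y ≡ K₀ (punchIn x₀ i) y
    K₁-off-x₀ i y = if-≟-no (FinP.punchInᵢ≢i x₀ i)

    s-punchIn : ∀ i k → s (punchIn x₀ i) (punchIn x₀ k) ≡ s i k
    s-punchIn = scalar-reindex (punchIn x₀) (FinP.punchIn-injective x₀ _ _) t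

    K₂-minor : ∀ i k → K₂ (punchIn x₀ i) (punchIn x₀ k) ≡ charMat t (blowUp ψ′ c′ B) i k
    K₂-minor i k with punchIn x₀ k ≟ p
    ... | yes refl = begin
        K₁ x y + 1ℤ * K₁ x x₀
      ≡⟨ cong₂ (λ a b → a + 1ℤ * b) (K₁-off-x₀ i y) (K₁-off-x₀ i x₀) ⟩
        (s x y - c y * B (ψ x) (ψ y)) + 1ℤ * (s x x₀ - c x₀ * B (ψ x) (ψ x₀))
      ≡⟨ cong₂ (λ a h → (s x y - c y * B (ψ x) (ψ y)) + 1ℤ * (a - c x₀ * B (ψ x) h))
               (if-≟-no (FinP.punchInᵢ≢i x₀ i)) (sym ψp≡ψx₀) ⟩
        (s x y - c y * B (ψ x) (ψ y)) + 1ℤ * (0ℤ - c x₀ * B (ψ x) (ψ y))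
      ≡⟨ merge (s x y) (c y) (c x₀) (B (ψ x) (ψ y)) ⟩
        s x y - (c y + c x₀) * B (ψ x) (ψ y)
      ≡⟨ cong (λ a → a - (c y + c x₀) * B (ψ x) (ψ y)) (s-punchIn i k) ⟩
        s i k - (c y + c x₀) * B (ψ x) (ψ y)
      ∎
      where
      x = punchIn x₀ i
      y = punchIn x₀ k
      merge : ∀ a u v b → (a - u * b) + 1ℤ * (0ℤ - v * b) ≡ a - (u + v) * b
      merge = solve-∀
    ... | no _ = begin
        K₁ x y                              ≡⟨ K₁-off-x₀ i y ⟩
        s x y - c y * B (ψ x) (ψ y)         ≡⟨ cong₂ (λ a w → a - w * B (ψ x) (ψ y))
                                                     (s-punchIn i k) (sym (ℤP.+-identityʳ (c y))) ⟩
        s i k - (c y + 0ℤ) * B (ψ x) (ψ y)  ∎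
      where
      x = punchIn x₀ i
      y = punchIn x₀ k

detℤ-collapse-bijective : ∀ {N m} (ψ : Fin N → Fin m) (σ : Fin m → Fin N) →
  (∀ j → ψ (σ j) ≡ j) → (∀ x → σ (ψ x) ≡ x) → ∀ c B t →
  detℤ N (charMat t (blowUp ψ c B)) ≡ detℤ m (charMat t (scaleCols (fibreWeight ψ c) B))
detℤ-collapse-bijective {N} {m} ψ σ ψσ σψ c B t = begin
  detℤ N K                          ≡⟨ detℤ-permute (Perm.permutation σ ψ σψ ψσ) K ⟨
  detℤ m (λ i j → K (σ i) (σ j))    ≡⟨ detℤ-cong m entry ⟩
  detℤ m (charMat t (scaleCols (fibreWeight ψ c) B)) ∎
  where
  open ≡-Reasoning
  K = charMat t (blowUp ψ c B)
  σ-injective : ∀ {i j} → σ i ≡ σ j → i ≡ j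
  σ-injective {i} {j} σi≡σj = trans (sym (ψσ i)) (trans (cong ψ σi≡σj) (ψσ j))
  weight : ∀ j → fibreWeight ψ c j ≡ c (σ j)
  weight j = trans (sum-single (λ x → if does (ψ x ≟ j) then c x else 0ℤ) (σ j)
                          λ x x≢σj → if-≟-no λ ψx≡j → x≢σj (trans (sym (σψ x)) (cong σ ψx≡j)))
                   (if-≟-yes (ψσ j))
  entry : ∀ i j → K (σ i) (σ j) ≡ charMat t (scaleCols (fibreWeight ψ c) B) i j
  entry i j = cong₂ _-_ (scalar-reindex σ σ-injective t i j)
                        (cong₂ _*_ (sym (weight j)) (cong₂ B (ψσ i) (ψσ j)))

detℤ-collapse-fibres : ∀ N {m} (ψ : Fin N → Fin m) (σ : Fin m → Fin N) → (∀ j → ψ (σ j) ≡ j) →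
  ∀ c B → ∃[ e ] ∀ t → detℤ N (charMat t (blowUp ψ c B))
                       ≡ t ^ e * detℤ m (charMat t (scaleCols (fibreWeight ψ c) B))
detℤ-collapse-fibres zero ψ σ ψσ c B =
  0 , λ t → trans (detℤ-collapse-bijective ψ σ ψσ (λ ()) c B t) (sym (ℤP.*-identityˡ _))
detℤ-collapse-fibres (suc N) {m} ψ σ ψσ c B with FinP.all? (λ x → σ (ψ x) ≟ x)
... | yes σψ = 0 , λ t → trans (detℤ-collapse-bijective ψ σ ψσ σψ c B t) (sym (ℤP.*-identityˡ _))
... | no ¬σψ with FinP.¬∀⟶∃¬ (suc N) _ (λ x → σ (ψ x) ≟ x) ¬σψ
... | x₀ , σψx₀≢x₀ = suc d , λ t → begin
    detℤ (suc N) (charMat t (blowUp ψ c B))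
  ≡⟨ detℤ-step t ⟩
    t * detℤ N (charMat t (blowUp ψ′ c′ B))
  ≡⟨ cong (t *_) (collapsed t) ⟩
    t * (t ^ d * detℤ m (charMat t (scaleCols (fibreWeight ψ′ c′) B)))
  ≡⟨ ℤP.*-assoc t (t ^ d) (detℤ m (charMat t (scaleCols (fibreWeight ψ′ c′) B))) ⟨
    t ^ suc d * detℤ m (charMat t (scaleCols (fibreWeight ψ′ c′) B))
  ≡⟨ cong (t ^ suc d *_) (detℤ-cong m λ i j → cong (λ w → scalar t i j - w * B i j) (fibreWeight-c′ j)) ⟩
    t ^ suc d * detℤ m (charMat t (scaleCols (fibreWeight ψ c) B))
  ∎
  where
  open ≡-Reasoning
  open CollapseStep ψ c B (σψx₀≢x₀ ∘ sym) (ψσ (ψ x₀))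
  σ≢x₀ : ∀ j → σ j ≢ x₀
  σ≢x₀ j σj≡x₀ = σψx₀≢x₀ (trans (cong (σ ∘ ψ) (sym σj≡x₀)) (trans (cong σ (ψσ j)) σj≡x₀))
  σ′ : Fin m → Fin N
  σ′ j = punchOut (σ≢x₀ j ∘ sym)
  ψ′σ′ : ∀ j → ψ′ (σ′ j) ≡ j
  ψ′σ′ j = trans (cong ψ (FinP.punchIn-punchOut _)) (ψσ j)
  IH = detℤ-collapse-fibres N ψ′ σ′ ψ′σ′ c′ B
  d = proj₁ IH
  collapsed = proj₂ IH


-- Integer polynomials

eval : Poly → ℤ → ℤ
eval []      t = 0ℤ
eval (a ∷ p) t = a + t * eval p t

eval-+P : ∀ p q t → eval (p +P q) t ≡ eval p t + eval q t
eval-+P []      q       t = sym (ℤP.+-identityˡ _)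
eval-+P (a ∷ p) []      t = sym (ℤP.+-identityʳ _)
eval-+P (a ∷ p) (b ∷ q) t =
  trans (cong (λ r → a + b + t * r) (eval-+P p q t)) (regroup a b t (eval p t) (eval q t))
  where regroup : ∀ a b t x y → a + b + t * (x + y) ≡ a + t * x + (b + t * y)
        regroup = solve-∀

eval-·P : ∀ c p t → eval (c ·P p) t ≡ c * eval p t
eval-·P c []      t = sym (ℤP.*-zeroʳ c)
eval-·P c (a ∷ p) t = trans (cong (λ r → c * a + t * r) (eval-·P c p t)) (regroup c a t (eval p t))
  where regroup : ∀ c a t x → c * a + t * (c * x) ≡ c * (a + t * x)
        regroup = solve-∀

eval-*P : ∀ p q t → eval (p *P q) t ≡ eval p t * eval q t
eval-*P []      q t = refl
eval-*P (a ∷ p) q t = begin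
    eval ((a ·P q) +P (+ 0 ∷ (p *P q))) t
  ≡⟨ eval-+P (a ·P q) (+ 0 ∷ (p *P q)) t ⟩
    eval (a ·P q) t + (+ 0 + t * eval (p *P q) t)
  ≡⟨ cong₂ (λ x y → x + (+ 0 + t * y)) (eval-·P a q t) (eval-*P p q t) ⟩
    a * eval q t + (+ 0 + t * (eval p t * eval q t))
  ≡⟨ regroup a t (eval p t) (eval q t) ⟩
    (a + t * eval p t) * eval q t
  ∎
  where
  open ≡-Reasoning
  regroup : ∀ a t x y → a * y + (+ 0 + t * (x * y)) ≡ (a + t * x) * y
  regroup = solve-∀

eval-sumFin : ∀ n (f : Fin n → Poly) t → eval (sumFin n f) t ≡ ∑[ i < n ] eval (f i) t
eval-sumFin zero    f t = refl
eval-sumFin (suc n) f t =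
  trans (eval-+P (f zero) (sumFin n (f ∘ suc)) t)
        (cong (λ s → eval (f zero) t + s) (eval-sumFin n (f ∘ suc) t))

eval-det : ∀ n (M : Fin n → Fin n → Poly) t → eval (det n M) t ≡ detℤ n (λ i j → eval (M i j) t)
eval-det zero    M t = cong (λ s → + 1 + s) (ℤP.*-zeroʳ t)
eval-det (suc n) M t = trans (eval-sumFin (suc n) T t) (sum-cong-≗ λ j → begin
    eval (T j) t
  ≡⟨ eval-·P (sign (toℕ j)) (M zero j *P det n (minor M j)) t ⟩
    sign (toℕ j) * eval (M zero j *P det n (minor M j)) t
  ≡⟨ cong (sign (toℕ j) *_) (eval-*P (M zero j) (det n (minor M j)) t) ⟩
    sign (toℕ j) * (eval (M zero j) t * eval (det n (minor M j)) t)
  ≡⟨ cong (λ d → sign (toℕ j) * (eval (M zero j) t * d)) (eval-det n (minor M j) t) ⟩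
    laplaceTerm n (λ i k → eval (M i k) t) j
  ∎)
  where
  open ≡-Reasoning
  T : Fin (suc n) → Poly
  T j = sign (toℕ j) ·P (M zero j *P det n (minor M j))

eval-charPoly : ∀ n (A : Mat n) t → eval (charPoly n A) t ≡ detℤ n (charMat t A)
eval-charPoly n A t = trans (eval-det n _ t) (detℤ-cong n entry)
  where
  entry : ∀ i j → eval (if does (i ≟ j) then (- A i j) ∷ (+ 1) ∷ [] else (- A i j) ∷ []) t
                  ≡ charMat t A i j
  entry i j with i ≟ j
  ... | yes _ = linear (A i j) t
    where linear : ∀ a t → - a + t * (+ 1 + t * 0ℤ) ≡ t - a
          linear = solve-∀
  ... | no _  = constant (A i j) t
    where constant : ∀ a t → - a + t * 0ℤ ≡ 0ℤ - a
          constant = solve-∀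

rootProduct : List ℤ → ℤ → ℤ
rootProduct []       t = 1ℤ
rootProduct (l ∷ ls) t = (t - l) * rootProduct ls t

eval-linearFactors : ∀ ls t → eval (linearFactors ls) t ≡ rootProduct ls t
eval-linearFactors []       t = cong (λ s → + 1 + s) (ℤP.*-zeroʳ t)
eval-linearFactors (l ∷ ls) t =
  trans (eval-*P ((- l) ∷ (+ 1) ∷ []) (linearFactors ls) t)
        (cong₂ _*_ (linear l t) (eval-linearFactors ls t))
  where linear : ∀ l t → - l + t * (+ 1 + t * 0ℤ) ≡ t - l
        linear = solve-∀

X^_*P_ : ℕ → Poly → Poly
X^ zero  *P q = q
X^ suc e *P q = + 0 ∷ (X^ e *P q)

eval-X^*P : ∀ e q t → eval (X^ e *P q) t ≡ t ^ e * eval q t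
eval-X^*P zero    q t = sym (ℤP.*-identityˡ _)
eval-X^*P (suc e) q t =
  trans (ℤP.+-identityˡ _) (trans (cong (t *_) (eval-X^*P e q t)) (sym (ℤP.*-assoc t (t ^ e) (eval q t))))

_-P_ : Poly → Poly → Poly
p -P q = p +P ((- 1ℤ) ·P q)

eval--P : ∀ p q t → eval (p -P q) t ≡ eval p t - eval q t
eval--P p q t = trans (eval-+P p ((- 1ℤ) ·P q) t)
                      (cong (λ s → eval p t + s) (trans (eval-·P (- 1ℤ) q t) (ℤP.-1*i≡-i (eval q t))))

coeff-+P : ∀ p q k → coeff (p +P q) k ≡ coeff p k + coeff q k
coeff-+P []      q       k       = sym (ℤP.+-identityˡ _)
coeff-+P (a ∷ p) []      k       = sym (ℤP.+-identityʳ _)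
coeff-+P (a ∷ p) (b ∷ q) zero    = refl
coeff-+P (a ∷ p) (b ∷ q) (suc k) = coeff-+P p q k

coeff-·P : ∀ c p k → coeff (c ·P p) k ≡ c * coeff p k
coeff-·P c []      k       = sym (ℤP.*-zeroʳ c)
coeff-·P c (a ∷ p) zero    = refl
coeff-·P c (a ∷ p) (suc k) = coeff-·P c p k

coeff--P : ∀ p q k → coeff (p -P q) k ≡ coeff p k - coeff q k
coeff--P p q k = trans (coeff-+P p ((- 1ℤ) ·P q) k)
                       (cong (λ s → coeff p k + s) (trans (coeff-·P (- 1ℤ) q k) (ℤP.-1*i≡-i (coeff q k))))

eval-difference-divisible : ∀ p a b → (a - b) ∣ (eval p a - eval p b)
eval-difference-divisible []      a b = divides 0ℤ (sym (ℤP.*-zeroˡ (a - b)))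
eval-difference-divisible (c ∷ p) a b = subst ((a - b) ∣_) (sym (rearrange c a b (eval p a) (eval p b)))
  (∣m∣n⇒∣m+n (∣n⇒∣m*n a (eval-difference-divisible p a b)) (∣m⇒∣m*n (eval p b) ∣-refl))
  where rearrange : ∀ c a b x y → c + a * x - (c + b * y) ≡ a * (x - y) + (a - b) * y
        rearrange = solve-∀

-- Evaluating at N = 1 + ∣ p(0) ∣ shows that N divides p(0), so p(0) = 0.
vanishing-off-0⇒vanishing : ∀ p → (∀ t → t ≢ 0ℤ → eval p t ≡ 0ℤ) → ∀ t → eval p t ≡ 0ℤ
vanishing-off-0⇒vanishing p p≡0 t with t ℤP.≟ 0ℤ
... | no t≢0  = p≡0 t t≢0
... | yes refl = at-0 (∣ v ∣) refl (∣⇒∣ᵤ N∣v)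
  where
  v = eval p 0ℤ
  N = + suc ∣ v ∣
  N∣-v : N ∣ - v
  N∣-v = subst₂ _∣_ (ℤP.+-identityʳ N)
                    (trans (cong (_- v) (p≡0 N λ ())) (ℤP.+-identityˡ (- v)))
                    (eval-difference-divisible p N 0ℤ)
  N∣v : N ∣ v
  N∣v = subst (N ∣_) (ℤP.neg-involutive v) (∣m⇒∣-m N∣-v)
  at-0 : ∀ a → ∣ v ∣ ≡ a → suc a ℕDiv.∣ a → v ≡ 0ℤ
  at-0 zero    ∣v∣≡0 _        = ℤP.∣i∣≡0⇒i≡0 ∣v∣≡0
  at-0 (suc a) _     1+a∣a = ⊥-elim (ℕDiv.>⇒∤ (ℕP.n<1+n (suc a)) 1+a∣a)

agreeing-off-0⇒agreeing : ∀ p q → (∀ t → t ≢ 0ℤ → eval p t ≡ eval q t) → ∀ t → eval p t ≡ eval q t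
agreeing-off-0⇒agreeing p q p≡q t = ℤP.i-j≡0⇒i≡j (eval p t) (eval q t) (trans (sym (eval--P p q t))
  (vanishing-off-0⇒vanishing (p -P q) (λ t t≢0 → trans (eval--P p q t) (ℤP.i≡j⇒i-j≡0 (p≡q t t≢0))) t))

eval-at-0 : ∀ a p → eval (a ∷ p) 0ℤ ≡ a
eval-at-0 a p = trans (cong (λ s → a + s) (ℤP.*-zeroˡ (eval p 0ℤ))) (ℤP.+-identityʳ a)

eval-zero⇒coeff-zero : ∀ p → (∀ t → eval p t ≡ 0ℤ) → ∀ k → coeff p k ≡ 0ℤ
eval-zero⇒coeff-zero []      p≡0 k       = refl
eval-zero⇒coeff-zero (a ∷ p) p≡0 zero    = trans (sym (eval-at-0 a p)) (p≡0 0ℤ)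
eval-zero⇒coeff-zero (a ∷ p) p≡0 (suc k) = eval-zero⇒coeff-zero p (vanishing-off-0⇒vanishing p tail≡0) k
  where
  tail≡0 : ∀ t → t ≢ 0ℤ → eval p t ≡ 0ℤ
  tail≡0 t t≢0 = ℤP.*-cancelˡ-≡ t (eval p t) 0ℤ {{ℤ.≢-nonZero t≢0}} (begin
    t * eval p t       ≡⟨ ℤP.+-identityˡ (t * eval p t) ⟨
    0ℤ + t * eval p t  ≡⟨ cong (λ c → c + t * eval p t) (eval-zero⇒coeff-zero (a ∷ p) p≡0 zero) ⟨
    eval (a ∷ p) t     ≡⟨ p≡0 t ⟩
    0ℤ                 ≡⟨ ℤP.*-zeroʳ t ⟨
    t * 0ℤ             ∎)
    where open ≡-Reasoning

coeff-zero⇒eval-zero : ∀ p → (∀ k → coeff p k ≡ 0ℤ) → ∀ t → eval p t ≡ 0ℤ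
coeff-zero⇒eval-zero []      _   t = refl
coeff-zero⇒eval-zero (a ∷ p) c≡0 t =
  trans (cong₂ (λ x y → x + t * y) (c≡0 zero) (coeff-zero⇒eval-zero p (c≡0 ∘ suc) t))
        (cong (λ s → 0ℤ + s) (ℤP.*-zeroʳ t))

≈P⇒eval≡ : ∀ p q → p ≈P q → ∀ t → eval p t ≡ eval q t
≈P⇒eval≡ p q p≈q t = ℤP.i-j≡0⇒i≡j (eval p t) (eval q t) (trans (sym (eval--P p q t))
  (coeff-zero⇒eval-zero (p -P q) (λ k → trans (coeff--P p q k) (ℤP.i≡j⇒i-j≡0 (p≈q k))) t))

eval≡⇒≈P : ∀ p q → (∀ t → eval p t ≡ eval q t) → p ≈P q
eval≡⇒≈P p q p≡q k = ℤP.i-j≡0⇒i≡j (coeff p k) (coeff q k) (trans (sym (coeff--P p q k))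
  (eval-zero⇒coeff-zero (p -P q) (λ t → trans (eval--P p q t) (ℤP.i≡j⇒i-j≡0 (p≡q t))) k))

charPoly-roots : ∀ n (A : Mat n) L → charPoly n A ≈P linearFactors L →
                 ∀ t → detℤ n (charMat t A) ≡ rootProduct L t
charPoly-roots n A L χ≈L t = begin
  detℤ n (charMat t A)        ≡⟨ eval-charPoly n A t ⟨
  eval (charPoly n A) t       ≡⟨ ≈P⇒eval≡ (charPoly n A) (linearFactors L) χ≈L t ⟩
  eval (linearFactors L) t    ≡⟨ eval-linearFactors L t ⟩
  rootProduct L t             ∎
  where open ≡-Reasoning

HasDegree≤ : Poly → ℕ → Set
HasDegree≤ p d = ∀ j → d ℕ.< j → coeff p j ≡ 0ℤ

Monic : Poly → ℕ → Set
Monic p d = HasDegree≤ p d × coeff p d ≡ 1ℤ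

coeff-sumFin : ∀ n (f : Fin n → Poly) k → coeff (sumFin n f) k ≡ ∑[ i < n ] coeff (f i) k
coeff-sumFin zero    f k = refl
coeff-sumFin (suc n) f k =
  trans (coeff-+P (f zero) (sumFin n (f ∘ suc)) k) (cong (λ s → coeff (f zero) k + s) (coeff-sumFin n (f ∘ suc) k))

coeff-*P : ∀ a p q j → coeff ((a ∷ p) *P q) j ≡ a * coeff q j + coeff (+ 0 ∷ (p *P q)) j
coeff-*P a p q j =
  trans (coeff-+P (a ·P q) (+ 0 ∷ (p *P q)) j) (cong (_+ coeff (+ 0 ∷ (p *P q)) j) (coeff-·P a q j))

*P-vanishingˡ : ∀ p q → (∀ j → coeff p j ≡ 0ℤ) → ∀ j → coeff (p *P q) j ≡ 0ℤ
*P-vanishingˡ []      q _   j = refl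
*P-vanishingˡ (a ∷ p) q p≡0 j =
  trans (coeff-*P a p q j) (cong₂ (λ x y → x * coeff q j + y) (p≡0 zero) (shifted j))
  where
  shifted : ∀ j → coeff (+ 0 ∷ (p *P q)) j ≡ 0ℤ
  shifted zero    = refl
  shifted (suc j) = *P-vanishingˡ p q (p≡0 ∘ suc) j

*P-degree : ∀ p q a b → HasDegree≤ p a → HasDegree≤ q b →
            HasDegree≤ (p *P q) (a ℕ.+ b) × coeff (p *P q) (a ℕ.+ b) ≡ coeff p a * coeff q b
*P-degree []      q a       b p≤a q≤b = (λ _ _ → refl) , refl
*P-degree (x ∷ p) q zero    b p≤a q≤b = degree , leading
  where
  shifted : ∀ j → coeff (+ 0 ∷ (p *P q)) j ≡ 0ℤ
  shifted zero    = refl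
  shifted (suc j) = *P-vanishingˡ p q (λ j → p≤a (suc j) (ℕ.s≤s ℕ.z≤n)) j
  degree : HasDegree≤ ((x ∷ p) *P q) b
  degree j b<j = trans (coeff-*P x p q j)
    (trans (cong₂ (λ u v → x * u + v) (q≤b j b<j) (shifted j)) (trans (ℤP.+-identityʳ (x * 0ℤ)) (ℤP.*-zeroʳ x)))
  leading : coeff ((x ∷ p) *P q) b ≡ x * coeff q b
  leading = trans (coeff-*P x p q b) (trans (cong (λ s → x * coeff q b + s) (shifted b)) (ℤP.+-identityʳ (x * coeff q b)))
*P-degree (x ∷ p) q (suc a) b p≤a q≤b = degree , leading
  where
  IH = *P-degree p q a b (λ j a<j → p≤a (suc j) (ℕ.s≤s a<j)) q≤b
  b<1+a+b : b ℕ.< suc (a ℕ.+ b)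
  b<1+a+b = ℕ.s≤s (ℕP.m≤n+m b a)
  degree : HasDegree≤ ((x ∷ p) *P q) (suc (a ℕ.+ b))
  degree (suc j) (ℕ.s≤s a+b<j) = trans (coeff-*P x p q (suc j))
    (trans (cong₂ (λ u v → x * u + v) (q≤b (suc j) (ℕP.<-trans b<1+a+b (ℕ.s≤s a+b<j))) (proj₁ IH j a+b<j))
           (trans (ℤP.+-identityʳ (x * 0ℤ)) (ℤP.*-zeroʳ x)))
  leading : coeff ((x ∷ p) *P q) (suc (a ℕ.+ b)) ≡ coeff p a * coeff q b
  leading = trans (coeff-*P x p q (suc (a ℕ.+ b)))
    (trans (cong₂ (λ u v → x * u + v) (q≤b _ b<1+a+b) (proj₂ IH))
           (trans (cong (_+ coeff p a * coeff q b) (ℤP.*-zeroʳ x)) (ℤP.+-identityˡ (coeff p a * coeff q b))))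

·P-degree : ∀ c p d → HasDegree≤ p d → HasDegree≤ (c ·P p) d
·P-degree c p d p≤d j d<j = trans (coeff-·P c p j) (trans (cong (c *_) (p≤d j d<j)) (ℤP.*-zeroʳ c))

det-degree : ∀ n (M : Fin n → Fin n → Poly) → (∀ i j → HasDegree≤ (M i j) 1) → HasDegree≤ (det n M) n
det-degree zero    M _ zero    ()
det-degree zero    M _ (suc j) _ = refl
det-degree (suc n) M M≤1 j n<j = trans (coeff-sumFin (suc n) T j) (sum-zero λ k →
  ·P-degree (sign (toℕ k)) (M zero k *P det n (minor M k)) (suc n)
    (proj₁ (*P-degree (M zero k) (det n (minor M k)) 1 n (M≤1 zero k)
                      (det-degree n (minor M k) λ i l → M≤1 (suc i) (punchIn k l))))
    j n<j)
  where
  T : Fin (suc n) → Poly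
  T k = sign (toℕ k) ·P (M zero k *P det n (minor M k))

det-leading : ∀ n (M : Fin n → Fin n → Poly) → (∀ i j → HasDegree≤ (M i j) 1) →
              (∀ i j → i ≢ j → HasDegree≤ (M i j) 0) → (∀ i → coeff (M i i) 1 ≡ 1ℤ) →
              coeff (det n M) n ≡ 1ℤ
det-leading zero    M _   _   _   = refl
det-leading (suc n) M M≤1 M≤0 Mᵢᵢ = begin
    coeff (det (suc n) M) (suc n)
  ≡⟨ coeff-sumFin (suc n) T (suc n) ⟩
    ∑[ j < suc n ] coeff (T j) (suc n)
  ≡⟨ sum-single (λ j → coeff (T j) (suc n)) zero off-diagonal ⟩
    coeff (T zero) (suc n)
  ≡⟨ coeff-·P (+ 1) (M zero zero *P det n (minor M zero)) (suc n) ⟩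
    + 1 * coeff (M zero zero *P det n (minor M zero)) (suc n)
  ≡⟨ ℤP.*-identityˡ _ ⟩
    coeff (M zero zero *P det n (minor M zero)) (suc n)
  ≡⟨ proj₂ (*P-degree (M zero zero) (det n (minor M zero)) 1 n (M≤1 zero zero) (minor-degree zero)) ⟩
    coeff (M zero zero) 1 * coeff (det n (minor M zero)) n
  ≡⟨ cong₂ _*_ (Mᵢᵢ zero) minor-leading ⟩
    1ℤ
  ∎
  where
  open ≡-Reasoning
  T : Fin (suc n) → Poly
  T j = sign (toℕ j) ·P (M zero j *P det n (minor M j))
  minor-degree : ∀ j → HasDegree≤ (det n (minor M j)) n
  minor-degree j = det-degree n (minor M j) λ i k → M≤1 (suc i) (punchIn j k)
  minor-leading : coeff (det n (minor M zero)) n ≡ 1ℤ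
  minor-leading = det-leading n (minor M zero) (λ i k → M≤1 (suc i) (suc k))
    (λ i k i≢k → M≤0 (suc i) (suc k) (i≢k ∘ FinP.suc-injective)) (Mᵢᵢ ∘ suc)
  off-diagonal : ∀ j → j ≢ zero → coeff (T j) (suc n) ≡ 0ℤ
  off-diagonal zero    0≢0 = ⊥-elim (0≢0 refl)
  off-diagonal (suc j) _   = ·P-degree (sign (toℕ (suc j))) (M zero (suc j) *P det n (minor M (suc j))) n
    (proj₁ (*P-degree (M zero (suc j)) (det n (minor M (suc j))) 0 n (M≤0 zero (suc j) λ ())
                      (minor-degree (suc j))))
    (suc n) (ℕP.n<1+n n)

linear-degree : ∀ a b → HasDegree≤ (a ∷ b ∷ []) 1
linear-degree a b zero          ()
linear-degree a b (suc zero)    (ℕ.s≤s ())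
linear-degree a b (suc (suc j)) _ = refl

charPoly-monic : ∀ n (A : Mat n) → Monic (charPoly n A) n
charPoly-monic n A = det-degree n M M≤1 , det-leading n M M≤1 M≤0 Mᵢᵢ
  where
  M : Fin n → Fin n → Poly
  M i j = if does (i ≟ j) then (- A i j) ∷ (+ 1) ∷ [] else (- A i j) ∷ []
  M≤1 : ∀ i j → HasDegree≤ (M i j) 1
  M≤1 i j with i ≟ j
  ... | yes _ = linear-degree _ _
  ... | no _  = λ { zero () ; (suc zero) (ℕ.s≤s ()) ; (suc (suc k)) _ → refl }
  M≤0 : ∀ i j → i ≢ j → HasDegree≤ (M i j) 0
  M≤0 i j i≢j with i ≟ j
  ... | yes i≡j = ⊥-elim (i≢j i≡j)
  ... | no _    = λ { zero () ; (suc k) _ → refl }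
  Mᵢᵢ : ∀ i → coeff (M i i) 1 ≡ 1ℤ
  Mᵢᵢ i = cong (λ p → coeff p 1) (if-≟-yes {x = i} refl)

linearFactors-monic : ∀ ls → Monic (linearFactors ls) (length ls)
linearFactors-monic []       = (λ { zero () ; (suc j) _ → refl }) , refl
linearFactors-monic (l ∷ ls) with *P-degree ((- l) ∷ (+ 1) ∷ []) (linearFactors ls) 1 (length ls)
                                            (linear-degree _ _) (proj₁ (linearFactors-monic ls))
... | degree , leading = degree , trans leading (trans (ℤP.*-identityˡ _) (proj₂ (linearFactors-monic ls)))

monic-degree-unique : ∀ {p q m d} → Monic p m → Monic q d → p ≈P q → m ≡ d
monic-degree-unique {p} {q} {m} {d} (p≤m , pₘ≡1) (q≤d , q_d≡1) p≈q with ℕP.<-cmp m d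
... | tri< m<d _ _ = contradiction (trans (sym q_d≡1) (trans (sym (p≈q d)) (p≤m d m<d))) λ ()
... | tri≈ _ m≡d _ = m≡d
... | tri> _ _ d<m = contradiction (trans (sym pₘ≡1) (trans (p≈q m) (q≤d m d<m))) λ ()


-- Integral eigenvalues

rootProduct-0⇒factor-t : ∀ L → rootProduct L 0ℤ ≡ 0ℤ →
                         ∃[ L₀ ] ∀ t → rootProduct L t ≡ t * rootProduct L₀ t
rootProduct-0⇒factor-t (l ∷ L) L[0]≡0 with ℤP.i*j≡0⇒i≡0∨j≡0 (0ℤ - l) L[0]≡0
... | inj₁ -l≡0 = L , λ t → cong (_* rootProduct L t) (trans (cong (λ r → t - r) l≡0) (ℤP.+-identityʳ t))
  where l≡0 : l ≡ 0ℤ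
        l≡0 = trans (sym (ℤP.neg-involutive l)) (cong -_ (trans (sym (ℤP.+-identityˡ (- l))) -l≡0))
... | inj₂ L[0]≡0′ with rootProduct-0⇒factor-t L L[0]≡0′
...   | L₀ , L≡tL₀ = l ∷ L₀ , λ t → trans (cong ((t - l) *_) (L≡tL₀ t)) (swap-t t l (rootProduct L₀ t))
  where swap-t : ∀ t l p → (t - l) * (t * p) ≡ t * ((t - l) * p)
        swap-t = solve-∀

rootProduct-divide-by-t : ∀ L r → (∀ t → rootProduct L t ≡ t * eval r t) →
                          ∃[ L₀ ] ∀ t → rootProduct L₀ t ≡ eval r t
rootProduct-divide-by-t L r L≡tr with rootProduct-0⇒factor-t L (trans (L≡tr 0ℤ) (ℤP.*-zeroˡ (eval r 0ℤ)))
... | L₀ , L≡tL₀ = L₀ , λ t →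
  trans (sym (eval-linearFactors L₀ t)) (agreeing-off-0⇒agreeing (linearFactors L₀) r off-0 t)
  where
  off-0 : ∀ t → t ≢ 0ℤ → eval (linearFactors L₀) t ≡ eval r t
  off-0 t t≢0 = trans (eval-linearFactors L₀ t)
    (ℤP.*-cancelˡ-≡ t (rootProduct L₀ t) (eval r t) {{ℤ.≢-nonZero t≢0}} (trans (sym (L≡tL₀ t)) (L≡tr t)))

rootProduct-divide-by-power : ∀ e L q → (∀ t → rootProduct L t ≡ t ^ e * eval q t) →
                              ∃[ L′ ] ∀ t → rootProduct L′ t ≡ eval q t
rootProduct-divide-by-power zero    L q L≡q = L , λ t → trans (L≡q t) (ℤP.*-identityˡ (eval q t))
rootProduct-divide-by-power (suc e) L q L≡tᵉq
  with rootProduct-divide-by-t L (X^ e *P q)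
         (λ t → trans (L≡tᵉq t) (trans (ℤP.*-assoc t (t ^ e) (eval q t)) (cong (t *_) (sym (eval-X^*P e q t)))))
... | L₀ , L₀≡ = rootProduct-divide-by-power e L₀ q λ t → trans (L₀≡ t) (eval-X^*P e q t)

integral-of-power-multiple : ∀ m (A : Mat m) e L → (∀ t → rootProduct L t ≡ t ^ e * detℤ m (charMat t A)) →
                             IsIntegralMatrix m A
integral-of-power-multiple m A e L L≡tᵉχ
  with rootProduct-divide-by-power e L (charPoly m A)
         (λ t → trans (L≡tᵉχ t) (cong (t ^ e *_) (sym (eval-charPoly m A t))))
... | L′ , L′≡χ = L′ , eval≡⇒≈P (charPoly m A) (linearFactors L′) λ t →
  trans (sym (L′≡χ t)) (sym (eval-linearFactors L′ t))

coprime-pow-divisor : ∀ {a b} m → Coprime b a → b ℕDiv.∣ a ℕ.^ m → b ≡ 1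
coprime-pow-divisor zero    _      b∣1    = ℕDiv.∣1⇒≡1 b∣1
coprime-pow-divisor (suc m) b⊥a b∣a*aᵐ = coprime-pow-divisor m b⊥a (coprime-divisor b⊥a b∣a*aᵐ)

abs-^ : ∀ i n → ∣ i ^ n ∣ ≡ ∣ i ∣ ℕ.^ n
abs-^ i zero    = refl
abs-^ i (suc n) = trans (ℤP.abs-* i (i ^ n)) (cong (∣ i ∣ ℕ.*_) (abs-^ i n))

detℤ-charMat-rescale : ∀ m (B : Mat m) g a b →
  detℤ m (charMat (a * g) ((b * g) ·ᴹ B)) ≡ g ^ m * detℤ m (charMat a (b ·ᴹ B))
detℤ-charMat-rescale m B g a b = trans (detℤ-cong m entry) (detℤ-scale m g (charMat a (b ·ᴹ B)))
  where
  entry : ∀ i j → charMat (a * g) ((b * g) ·ᴹ B) i j ≡ (g ·ᴹ charMat a (b ·ᴹ B)) i j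
  entry i j = trans (cong (_- b * g * B i j) (scalar-* g a i j)) (factor g (scalar a i j) b (B i j))
    where factor : ∀ g s b x → g * s - b * g * x ≡ g * (s - b * x)
          factor = solve-∀

-- Modulo b the matrix a I - b B is a I, whose determinant is a ^ m.
charMat-singular⇒pow-divisible : ∀ m (B : Mat m) a b → detℤ m (charMat a (b ·ᴹ B)) ≡ 0ℤ → b ∣ a ^ m
charMat-singular⇒pow-divisible m B a b singular = subst (b ∣_) (ℤP.neg-involutive (a ^ m)) (∣m⇒∣-m b∣-aᵐ)
  where
  congruent : b ∣ (detℤ m (charMat a (b ·ᴹ B)) - detℤ m (scalar a))
  congruent = detℤ-congruent m b (charMat a (b ·ᴹ B)) (scalar a) λ i j →
    divides (- B i j) (shift (scalar a i j) b (B i j))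
    where shift : ∀ s b x → s - b * x - s ≡ - x * b
          shift = solve-∀
  b∣-aᵐ : b ∣ - (a ^ m)
  b∣-aᵐ = subst (b ∣_) (trans (cong₂ _-_ singular (detℤ-scalar m a)) (ℤP.+-identityˡ (- (a ^ m)))) congruent

-- With g = gcd(l, k), l = a g and k = b g: a I - b B is singular, so b ∣ aᵐ, and b = 1 by coprimality.
charMat-singular⇒divisible : ∀ m (B : Mat m) k l → k ≢ 0 → detℤ m (charMat l (+ k ·ᴹ B)) ≡ 0ℤ → + k ∣ l
charMat-singular⇒divisible m B k l k≢0 singular = subst (_∣ l) (cong +_ g≡k) g∣l
  where
  g = gcd ∣ l ∣ k
  g≢0 : g ≢ 0
  g≢0 = gcd[m,n]≢0 ∣ l ∣ k (inj₂ k≢0)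
  instance
    g-nonZero : ℕ.NonZero g
    g-nonZero = ℕ.≢-nonZero g≢0
  g∣l : + g ∣ l
  g∣l = ∣ᵤ⇒∣ (gcd[m,n]∣m ∣ l ∣ k)
  a′ = _∣_.quotient g∣l
  a = ∣ l ∣ ℕ./ g
  b = k ℕ./ g
  k≡bg : k ≡ b ℕ.* g
  k≡bg = sym (m/n*n≡m (gcd[m,n]∣n ∣ l ∣ k))
  ∣a′∣≡a : ∣ a′ ∣ ≡ a
  ∣a′∣≡a = ℕP.*-cancelʳ-≡ ∣ a′ ∣ a g (begin
    ∣ a′ ∣ ℕ.* g   ≡⟨ ℤP.abs-* a′ (+ g) ⟨
    ∣ a′ * + g ∣   ≡⟨ cong ∣_∣ (_∣_.equality g∣l) ⟨
    ∣ l ∣          ≡⟨ m/n*n≡m (gcd[m,n]∣m ∣ l ∣ k) ⟨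
    a ℕ.* g        ∎)
    where open ≡-Reasoning
  singular′ : detℤ m (charMat a′ (+ b ·ᴹ B)) ≡ 0ℤ
  singular′ with ℤP.i*j≡0⇒i≡0∨j≡0 ((+ g) ^ m) (begin
      (+ g) ^ m * detℤ m (charMat a′ (+ b ·ᴹ B))      ≡⟨ detℤ-charMat-rescale m B (+ g) a′ (+ b) ⟨
      detℤ m (charMat (a′ * + g) ((+ b * + g) ·ᴹ B))  ≡⟨ cong₂ (λ x y → detℤ m (charMat x (y ·ᴹ B)))
                                                             (_∣_.equality g∣l) (trans (cong +_ k≡bg) (ℤP.pos-* b g)) ⟨
      detℤ m (charMat l (+ k ·ᴹ B))                   ≡⟨ singular ⟩
      0ℤ                                              ∎)
    where open ≡-Reasoning
  ... | inj₁ gᵐ≡0 = contradiction (ℤP.+-injective (ℤP.i^n≡0⇒i≡0 (+ g) m gᵐ≡0)) g≢0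
  ... | inj₂ det≡0 = det≡0
  b≡1 : b ≡ 1
  b≡1 = coprime-pow-divisor m (Coprime.sym (coprime-/gcd ∣ l ∣ k))
          (subst (b ℕDiv.∣_) (trans (abs-^ a′ m) (cong (ℕ._^ m) ∣a′∣≡a))
                 (∣⇒∣ᵤ (charMat-singular⇒pow-divisible m B a′ (+ b) singular′)))
  g≡k : g ≡ k
  g≡k = sym (trans k≡bg (trans (cong (ℕ._* g) b≡1) (ℕP.*-identityˡ g)))

divisible-roots : ∀ k L → (∀ l → rootProduct L l ≡ 0ℤ → k ∣ l) → ∃[ L″ ] L ≡ map (_* k) L″
divisible-roots k []      _ = [] , refl
divisible-roots k (l ∷ L) roots-divisible
  with roots-divisible l (trans (cong (_* rootProduct L l) (ℤP.+-inverseʳ l)) (ℤP.*-zeroˡ (rootProduct L l)))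
     | divisible-roots k L
         (λ l′ L[l′]≡0 → roots-divisible l′ (trans (cong ((l′ - l) *_) L[l′]≡0) (ℤP.*-zeroʳ (l′ - l))))
... | divides q l≡qk | L″ , L≡kL″ = q ∷ L″ , cong₂ _∷_ l≡qk L≡kL″

rootProduct-scale : ∀ k L t → rootProduct (map (_* k) L) (k * t) ≡ k ^ length L * rootProduct L t
rootProduct-scale k []      t = refl
rootProduct-scale k (q ∷ L) t = trans (cong ((k * t - q * k) *_) (rootProduct-scale k L t))
                                      (regroup k t q (k ^ length L) (rootProduct L t))
  where regroup : ∀ k t q p r → (k * t - q * k) * (p * r) ≡ k * p * ((t - q) * r)
        regroup = solve-∀

integral-of-scaled : ∀ m (B : Mat m) k → k ≢ 0 → IsIntegralMatrix m (+ k ·ᴹ B) → IsIntegralMatrix m B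
integral-of-scaled m B k k≢0 (L , χ≈L) = L″ , eval≡⇒≈P (charPoly m B) (linearFactors L″) λ t →
  ℤP.*-cancelˡ-≡ ((+ k) ^ m) (eval (charPoly m B) t) (eval (linearFactors L″) t) {{kᵐ-nonZero}} (begin
    (+ k) ^ m * eval (charPoly m B) t        ≡⟨ cong ((+ k) ^ m *_) (eval-charPoly m B t) ⟩
    (+ k) ^ m * detℤ m (charMat t B)         ≡⟨ detℤ-scale m (+ k) (charMat t B) ⟨
    detℤ m (+ k ·ᴹ charMat t B)              ≡⟨ detℤ-cong m (scale-entry t) ⟩
    detℤ m (charMat (+ k * t) (+ k ·ᴹ B))    ≡⟨ charPoly-roots m (+ k ·ᴹ B) L χ≈L (+ k * t) ⟩
    rootProduct L (+ k * t)                  ≡⟨ cong (λ L → rootProduct L (+ k * t)) L≡kL″ ⟩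
    rootProduct (map (_* + k) L″) (+ k * t)  ≡⟨ rootProduct-scale (+ k) L″ t ⟩
    (+ k) ^ length L″ * rootProduct L″ t     ≡⟨ cong₂ (λ d r → (+ k) ^ d * r)
                                                       length≡m (sym (eval-linearFactors L″ t)) ⟩
    (+ k) ^ m * eval (linearFactors L″) t    ∎)
  where
  open ≡-Reasoning
  divided = divisible-roots (+ k) L λ l L[l]≡0 →
    charMat-singular⇒divisible m B k l k≢0 (trans (charPoly-roots m (+ k ·ᴹ B) L χ≈L l) L[l]≡0)
  L″ = proj₁ divided
  L≡kL″ = proj₂ divided
  length≡m : length L″ ≡ m
  length≡m = begin
    length L″                ≡⟨ length-map (_* + k) L″ ⟨
    length (map (_* + k) L″) ≡⟨ cong length L≡kL″ ⟨
    length L                 ≡⟨ monic-degree-unique {charPoly m (+ k ·ᴹ B)} {linearFactors L}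
                                  (charPoly-monic m (+ k ·ᴹ B)) (linearFactors-monic L) χ≈L ⟨
    m                        ∎
  kᵐ-nonZero : ℤ.NonZero ((+ k) ^ m)
  kᵐ-nonZero = ℤ.≢-nonZero λ kᵐ≡0 → k≢0 (ℤP.+-injective (ℤP.i^n≡0⇒i≡0 (+ k) m kᵐ≡0))
  scale-entry : ∀ t i j → (+ k ·ᴹ charMat t B) i j ≡ charMat (+ k * t) (+ k ·ᴹ B) i j
  scale-entry t i j = trans (distrib (+ k) (scalar t i j) (B i j))
    (cong (_- + k * B i j) (sym (trans (cong (λ x → scalar x i j) (ℤP.*-comm (+ k) t)) (scalar-* (+ k) t i j))))
    where distrib : ∀ k s b → k * (s - b) ≡ k * s - k * b
          distrib = solve-∀

-- Quotients of groups

toGroup : FiniteGroup → Group 0ℓ 0ℓ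
toGroup G = record
  { Carrier = Elt G ; _≈_ = _≡_ ; _∙_ = _∙_ G ; ε = e G ; _⁻¹ = _⁻¹ G
  ; isGroup = record
    { isMonoid = record
      { isSemigroup = record
        { isMagma = record { isEquivalence = isEquivalence ; ∙-cong = cong₂ (_∙_ G) }
        ; assoc = assoc G }
      ; identity = identityˡ G , identityʳ G }
    ; inverse = inverseˡ G , inverseʳ G
    ; ⁻¹-cong = cong (_⁻¹ G) } }

module GroupProperties (G : FiniteGroup) = Algebra.Properties.Group (toGroup G)

rightMultiplication : (G : FiniteGroup) → Elt G → Permutation′ (order G)
rightMultiplication G a = Perm.permutation (λ x → _∙_ G x a) (λ x → _∙_ G x (_⁻¹ G a))
  (λ x → trans (assoc G x (_⁻¹ G a) a) (trans (cong (_∙_ G x) (inverseˡ G a)) (identityʳ G x)))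
  (λ x → trans (assoc G x a (_⁻¹ G a)) (trans (cong (_∙_ G x) (inverseʳ G a)) (identityʳ G x)))

count : ∀ {n} → (Fin n → Bool) → ℕ
count {zero}  b = 0
count {suc n} b = (if b zero then 1 else 0) ℕ.+ count (b ∘ suc)

sum-indicator : ∀ {n} (b : Fin n → Bool) → ∑[ x < n ] (if b x then 1ℤ else 0ℤ) ≡ + count b
sum-indicator {zero}  b = refl
sum-indicator {suc n} b with b zero
... | true  = cong (λ s → 1ℤ + s) (sum-indicator (b ∘ suc))
... | false = trans (ℤP.+-identityˡ _) (sum-indicator (b ∘ suc))

count-nonzero : ∀ {n} (b : Fin n → Bool) x → b x ≡ true → count b ≢ 0
count-nonzero b zero    bx≡true with b zero
count-nonzero b zero    ()      | false
count-nonzero b zero    _       | true = λ ()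
count-nonzero b (suc x) bx≡true with b zero
... | true  = λ ()
... | false = count-nonzero (b ∘ suc) x bx≡true

kernelSize : (G H : FiniteGroup) → (Elt G → Elt H) → ℕ
kernelSize G H φ = count λ x → does (φ x ≟ e H)

module Hom {G H : FiniteGroup} {φ : Elt G → Elt H} (φ-hom : IsHomomorphism G H φ) where

  hom-identity : φ (e G) ≡ e H
  hom-identity = GroupProperties.identityˡ-unique H (φ (e G)) (φ (e G))
    (trans (sym (φ-hom (e G) (e G))) (cong φ (identityˡ G (e G))))

  hom-inverse : ∀ x → φ (_⁻¹ G x) ≡ _⁻¹ H (φ x)
  hom-inverse x = GroupProperties.inverseˡ-unique H (φ (_⁻¹ G x)) (φ x)
    (trans (sym (φ-hom (_⁻¹ G x) x)) (trans (cong φ (inverseˡ G x)) hom-identity))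

  classFunction-∘ : ∀ {f} → IsClassFunction H f → IsClassFunction G (f ∘ φ)
  classFunction-∘ {f} f-class x g = trans
    (cong f (trans (φ-hom (_∙_ G x g) (_⁻¹ G x)) (cong₂ (_∙_ H) (φ-hom x g) (hom-inverse x))))
    (f-class (φ x) (φ g))

  inverseSymmetric-∘ : ∀ {f} → IsInverseSymmetric H f → IsInverseSymmetric G (f ∘ φ)
  inverseSymmetric-∘ {f} f-symmetric g = trans (f-symmetric (φ g)) (cong f (sym (hom-inverse g)))

  cayleyAdj-∘ : ∀ f x y → CayleyAdj G (f ∘ φ) x y ≡ CayleyAdj H f (φ x) (φ y)
  cayleyAdj-∘ f x y = cong f (trans (φ-hom x (_⁻¹ G y)) (cong (_∙_ H (φ x)) (hom-inverse y)))

  kernelSize≢0 : kernelSize G H φ ≢ 0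
  kernelSize≢0 = count-nonzero (λ x → does (φ x ≟ e H)) (e G) (dec-true (φ (e G) ≟ e H) hom-identity)

  fibreWeight-hom : (s : Elt H → Elt G) → (∀ j → φ (s j) ≡ j) →
                    ∀ j → fibreWeight φ (λ _ → 1ℤ) j ≡ + kernelSize G H φ
  fibreWeight-hom s φs≡id j = begin
    ∑[ x < order G ] (if does (φ x ≟ j) then 1ℤ else 0ℤ)
      ≡⟨ sum-permute _ (rightMultiplication G (s j)) ⟩
    ∑[ x < order G ] (if does (φ (_∙_ G x (s j)) ≟ j) then 1ℤ else 0ℤ)
      ≡⟨ sum-cong-≗ translate ⟩
    ∑[ x < order G ] (if does (φ x ≟ e H) then 1ℤ else 0ℤ)
      ≡⟨ sum-indicator (λ x → does (φ x ≟ e H)) ⟩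
    + kernelSize G H φ
      ∎
    where
    open ≡-Reasoning
    translate : ∀ x → (if does (φ (_∙_ G x (s j)) ≟ j) then 1ℤ else 0ℤ)
                      ≡ (if does (φ x ≟ e H) then 1ℤ else 0ℤ)
    translate x with φ (_∙_ G x (s j)) ≟ j | φ x ≟ e H
    ... | yes _     | yes _    = refl
    ... | no _      | no _     = refl
    ... | yes φxs≡j | no φx≢e  = ⊥-elim (φx≢e (GroupProperties.identityˡ-unique H (φ x) j
                                   (trans (cong (_∙_ H (φ x)) (sym (φs≡id j))) (trans (sym (φ-hom x (s j))) φxs≡j))))
    ... | no φxs≢j  | yes φx≡e = ⊥-elim (φxs≢j
                                   (trans (φ-hom x (s j)) (trans (cong₂ (_∙_ H) φx≡e (φs≡id j)) (identityˡ H j))))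

  charMat-inflate : IsSurjective G H φ → ∀ (B : Mat (order H)) →
    ∃[ d ] ∀ t → detℤ (order G) (charMat t (λ x y → B (φ x) (φ y)))
                 ≡ t ^ d * detℤ (order H) (charMat t (+ kernelSize G H φ ·ᴹ B))
  charMat-inflate φ-surj B = d , λ t → begin
      detℤ (order G) (charMat t (λ x y → B (φ x) (φ y)))
    ≡⟨ detℤ-cong (order G) (λ x y → cong (λ a → scalar t x y - a) (sym (ℤP.*-identityˡ (B (φ x) (φ y))))) ⟩
      detℤ (order G) (charMat t (blowUp φ (λ _ → 1ℤ) B))
    ≡⟨ proj₂ collapsed t ⟩
      t ^ d * detℤ (order H) (charMat t (scaleCols (fibreWeight φ (λ _ → 1ℤ)) B))
    ≡⟨ cong (t ^ d *_) (detℤ-cong (order H) λ i j →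
         cong (λ w → scalar t i j - w * B i j) (fibreWeight-hom s φs≡id j)) ⟩
      t ^ d * detℤ (order H) (charMat t (+ kernelSize G H φ ·ᴹ B))
    ∎
    where
    open ≡-Reasoning
    s : Elt H → Elt G
    s j = proj₁ (φ-surj j)
    φs≡id : ∀ j → φ (s j) ≡ j
    φs≡id j = proj₂ (φ-surj j)
    collapsed = detℤ-collapse-fibres (order G) φ s φs≡id (λ _ → 1ℤ) B
    d = proj₁ collapsed

mainTheorem10 : (G H : FiniteGroup) → IsQuotientOf H G →
    FCayleyColourIntegral G → FCayleyColourIntegral H
mainTheorem10 G H (φ , φ-hom , φ-surj) G-integral f f-class f-symmetric =
  integral-of-scaled (order H) B k kernelSize≢0
    (integral-of-power-multiple (order H) kB d L λ t → begin
      rootProduct L t                                     ≡⟨ charPoly-roots (order G) A L χ≈L t ⟨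
      detℤ (order G) (charMat t A)                        ≡⟨ detℤ-cong (order G) (A≡B∘φ t) ⟩
      detℤ (order G) (charMat t (λ x y → B (φ x) (φ y)))  ≡⟨ proj₂ inflated t ⟩
      t ^ d * detℤ (order H) (charMat t kB)               ∎)
  where
  open ≡-Reasoning
  open Hom {G} {H} {φ} φ-hom
  A = CayleyAdj G (f ∘ φ)
  B = CayleyAdj H f
  k = kernelSize G H φ
  kB = + k ·ᴹ B
  A≡B∘φ : ∀ t x y → charMat t A x y ≡ charMat t (λ x y → B (φ x) (φ y)) x y
  A≡B∘φ t x y = cong (λ a → scalar t x y - a) (cayleyAdj-∘ f x y)
  A-integral = G-integral (f ∘ φ) (classFunction-∘ f-class) (inverseSymmetric-∘ f-symmetric)
  L = proj₁ A-integral
  χ≈L = proj₂ A-integral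
  inflated = charMat-inflate φ-surj B
  d = proj₁ inflated
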